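{- Let $G$ be a finite graph with open faces containing a closed face $X$ whose boundary is a $4$-cycle $v_1v_2v_3v_4$, with sides $e_k=v_kv_{k+1}$ (indices mod $4$), and suppose that for each $k$ the other face bordering $e_k$ is $F_k$, where $F_1,F_2,F_3,F_4$ are four distinct faces of $G$ (open or closed). Write $y_k$ for the edge variable of $e_k$. Form $G'$ by deleting the edges $e_1,\dots,e_4$ (and the face $X$), adding four new vertices $u_1,\dots,u_4$, new edges $g_k=v_ku_k$ whose edge variables are set equal to $1$, and new edges $s_k=u_ku_{k+1}$ whose edge variable is $y_{k+2}$ (indices mod $4$); the new edges $s_1,\dots,s_4$ bound a new closed face $X'$, and for each $k$ the boundary edge $e_k$ of $F_k$ is replaced by the three edges $g_k,s_k,g_{k+1}$ (so $F_k$ keeps its open/closed status), all else unchanged. Then $m(G')=m(G)$, where in $m(G')$ the face variable of $X'$ is replaced by $$x_{X'}=\frac{y_1y_3\,x_{F_2}x_{F_4}+y_2y_4\,x_{F_1}x_{F_3}}{x_X}.$$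
   Context: A graph with open faces is a finite connected planar graph $G_0$ with a fixed planar embedding, together with a partition of the cyclic sequence of edges of the boundary of the outer face into edge-disjoint consecutive paths; each such path is an open face (its edges are its boundary edges), and each bounded face of $G_0$ is a closed face. The faces of $G$ are its open and closed faces. To each face $F$ attach a variable $x_F$ and to each edge $e$ a variable $y_e$. A matching of $G$ is a set $M$ of edges such that every vertex lies on exactly one edge of $M$. For a face $F$ let $\alpha_F$ be the number of boundary edges of $F$ in $M$ and $\beta_F$ the number not in $M$; set $\epsilon(F)=\lceil(\beta_F-\alpha_F)/2\rceil-1$ if $F$ is closed and $\epsilon(F)=\lceil(\beta_F-\alpha_F)/2\rceil$ if $F$ is open. The matching monomial is $m(M)=\prod_{e\in M}y_e\prod_F x_F^{\epsilon(F)}$ and $m(G)=\sum_M m(M)$ over all matchings of $G$. -}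

module Defs where

open import Level using (Level)
open import Data.Nat as ℕ using (ℕ; zero; suc; ⌈_/2⌉; ⌊_/2⌋; _≡ᵇ_)
open import Data.Integer as ℤ using (ℤ; +_; -[1+_])
open import Data.Fin using (Fin; zero; suc)
open import Data.Fin.Properties using (_≟_)
open import Data.Bool using (Bool; true; false; not; _∧_; _∨_; if_then_else_)
open import Data.Product using (Σ; ∃; ∃-syntax; _×_; _,_; proj₁; proj₂)
open import Data.Sum using (_⊎_; inj₁; inj₂)
open import Data.Unit using (⊤; tt)
open import Data.List using (List; []; _∷_; map; _++_; foldr)
open import Relation.Nullary using (¬_; does)
open import Relation.Binary.PropositionalEquality using (_≡_; _≢_)
open import Algebra.Bundles using (CommutativeRing)

-- A dart of edge e is (e , b); b = false is the dart leaving src e,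
-- b = true the dart leaving tgt e.
Dart : ℕ → Set
Dart n = Fin n × Bool

α : ∀ {n} → Dart n → Dart n
α (e , b) = e , not b

tailOf : ∀ {nE nV} → (Fin nE → Fin nV) → (Fin nE → Fin nV) → Dart nE → Fin nV
tailOf src tgt (e , false) = src e
tailOf src tgt (e , true)  = tgt e

iter : ∀ {a} {A : Set a} → (A → A) → ℕ → A → A
iter f zero    x = x
iter f (suc k) x = iter f k (f x)

data Conn {n : ℕ} (σ : Dart n → Dart n) : Dart n → Dart n → Set where
  here : ∀ {d} → Conn σ d d
  viaσ : ∀ {d d'} → Conn σ (σ d) d' → Conn σ d d'
  viaα : ∀ {d d'} → Conn σ (α d) d' → Conn σ d d'

SameEnds : ∀ {A : Set} → A → A → A → A → Set
SameEnds a b c d = (a ≡ c × b ≡ d) ⊎ (a ≡ d × b ≡ c)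

-- A finite connected planar graph with a fixed planar embedding is given
-- by a rotation system σ (its cycles are the cyclic orders of darts
-- around each vertex); the faces of the embedding are the orbits of
-- φ = σ ∘ α; planarity is Euler's formula V - E + (#φ-orbits) = 2.
-- One φ-orbit is the outer face; its cyclic dart sequence is cut into
-- consecutive runs (the open faces); the other φ-orbits are the closed
-- faces.  faceOf d is the face (open or closed) on whose boundary the
-- dart d lies.

record GraphWithOpenFaces : Set where
  field
    nV nE nF : ℕ
    src tgt : Fin nE → Fin nV
    σ σ⁻ : Dart nE → Dart nE
    σ-inv₁ : ∀ d → σ (σ⁻ d) ≡ d
    σ-inv₂ : ∀ d → σ⁻ (σ d) ≡ d
    σ-vertex : ∀ d → tailOf src tgt (σ d) ≡ tailOf src tgt d
    σ-cyclic : ∀ d d' → tailOf src tgt d ≡ tailOf src tgt d' →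
               ∃[ k ] iter σ k d ≡ d'
    vertex-dart : ∀ v → ∃[ d ] tailOf src tgt d ≡ v
    connected : ∀ d d' → Conn σ d d'
    nO : ℕ
    orbit : Dart nE → Fin nO
    orbit-φ : ∀ d → orbit (σ (α d)) ≡ orbit d
    orbit-same : ∀ d d' → orbit d ≡ orbit d' →
                 ∃[ k ] iter (λ x → σ (α x)) k d ≡ d'
    orbit-surj : ∀ o → ∃[ d ] orbit d ≡ o
    euler : nV ℕ.+ nO ≡ nE ℕ.+ 2
    outer : Fin nO
    faceOf : Dart nE → Fin nF
    isOpen : Fin nF → Bool
    faceOf-surj : ∀ f → ∃[ d ] faceOf d ≡ f
    closed-faces : ∀ d → orbit d ≢ outer → isOpen (faceOf d) ≡ false
    closed-same₁ : ∀ d d' → orbit d ≢ outer → orbit d' ≢ outer →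
                   faceOf d ≡ faceOf d' → orbit d ≡ orbit d'
    closed-same₂ : ∀ d d' → orbit d ≢ outer → orbit d' ≢ outer →
                   orbit d ≡ orbit d' → faceOf d ≡ faceOf d'
    -- open faces = consecutive runs of the outer boundary;
    -- cut d = true iff d is the first dart of a run
    open-faces : ∀ d → orbit d ≡ outer → isOpen (faceOf d) ≡ true
    cut : Dart nE → Bool
    cut-outer : ∀ d → cut d ≡ true → orbit d ≡ outer
    cut-exists : ∃[ d ] cut d ≡ true
    run-step : ∀ d → orbit d ≡ outer → cut (σ (α d)) ≡ false →
               faceOf (σ (α d)) ≡ faceOf d
    run-distinct : ∀ d d' → cut d ≡ true → cut d' ≡ true →
                   faceOf d ≡ faceOf d' → d ≡ d'

open GraphWithOpenFaces

countFin : (n : ℕ) → (Fin n → Bool) → ℕ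
countFin zero    p = 0
countFin (suc n) p = (if p zero then 1 else 0) ℕ.+ countFin n (λ i → p (suc i))

countDart : (n : ℕ) → (Dart n → Bool) → ℕ
countDart n p = countFin n (λ e → p (e , false)) ℕ.+ countFin n (λ e → p (e , true))

allFin : (n : ℕ) → (Fin n → Bool) → Bool
allFin zero    p = true
allFin (suc n) p = p zero ∧ allFin n (λ i → p (suc i))

consB : ∀ {n} → Bool → (Fin n → Bool) → Fin (suc n) → Bool
consB b f zero    = b
consB b f (suc i) = f i

allSubsets : (n : ℕ) → List (Fin n → Bool)
allSubsets zero    = (λ ()) ∷ []
allSubsets (suc n) = map (consB false) (allSubsets n) ++ map (consB true) (allSubsets n)

incident : (G : GraphWithOpenFaces) → Fin (nE G) → Fin (nV G) → Bool
incident G e v = does (src G e ≟ v) ∨ does (tgt G e ≟ v)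

isMatching : (G : GraphWithOpenFaces) → (Fin (nE G) → Bool) → Bool
isMatching G M = allFin (nV G) (λ v → countFin (nE G) (λ e → M e ∧ incident G e v) ≡ᵇ 1)

-- α_F and β_F (boundary edges counted along the boundary, i.e. per dart)
alphaF : (G : GraphWithOpenFaces) → (Fin (nE G) → Bool) → Fin (nF G) → ℕ
alphaF G M F = countDart (nE G) (λ d → does (faceOf G d ≟ F) ∧ M (proj₁ d))

betaF : (G : GraphWithOpenFaces) → (Fin (nE G) → Bool) → Fin (nF G) → ℕ
betaF G M F = countDart (nE G) (λ d → does (faceOf G d ≟ F) ∧ not (M (proj₁ d)))

ceilHalf : ℤ → ℤ
ceilHalf (+ n)     = + ⌈ n /2⌉
ceilHalf -[1+ n ]  = ℤ.- (+ ⌊ suc n /2⌋)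

epsilon : (G : GraphWithOpenFaces) → (Fin (nE G) → Bool) → Fin (nF G) → ℤ
epsilon G M F with isOpen G F
... | true  = ceilHalf ((+ betaF G M F) ℤ.- (+ alphaF G M F))
... | false = ceilHalf ((+ betaF G M F) ℤ.- (+ alphaF G M F)) ℤ.- (+ 1)

-- Evaluation of m(G) in a commutative ring, face variables being units

module Eval {c ℓ : Level} (R : CommutativeRing c ℓ) where
  open CommutativeRing R using (Carrier; _+_; _*_; 0#; 1#)

  powZ : Carrier → Carrier → ℤ → Carrier
  powZ x xi (+ zero)     = 1#
  powZ x xi (+ suc n)    = x * powZ x xi (+ n)
  powZ x xi -[1+ zero ]  = xi
  powZ x xi -[1+ suc n ] = xi * powZ x xi -[1+ n ]

  prodFin : (n : ℕ) → (Fin n → Carrier) → Carrier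
  prodFin zero    f = 1#
  prodFin (suc n) f = f zero * prodFin n (λ i → f (suc i))

  monomial : (G : GraphWithOpenFaces) (x xi : Fin (nF G) → Carrier)
             (y : Fin (nE G) → Carrier) → (Fin (nE G) → Bool) → Carrier
  monomial G x xi y M =
    prodFin (nE G) (λ e → if M e then y e else 1#) *
    prodFin (nF G) (λ F → powZ (x F) (xi F) (epsilon G M F))

  mPoly : (G : GraphWithOpenFaces) (x xi : Fin (nF G) → Carrier)
          (y : Fin (nE G) → Carrier) → Carrier
  mPoly G x xi y =
    foldr (λ M acc → (if isMatching G M then monomial G x xi y M else 0#) + acc)
          0# (allSubsets (nE G))

next4 : Fin 4 → Fin 4
next4 zero                   = suc zero
next4 (suc zero)             = suc (suc zero)
next4 (suc (suc zero))       = suc (suc (suc zero))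
next4 (suc (suc (suc zero))) = zero

prev4 : Fin 4 → Fin 4
prev4 zero                   = suc (suc (suc zero))
prev4 (suc zero)             = zero
prev4 (suc (suc zero))       = suc zero
prev4 (suc (suc (suc zero))) = suc (suc zero)

-- indices 0,1,2,3 stand for the paper's 1,2,3,4
record SquareFace (G : GraphWithOpenFaces) : Set where
  field
    X : Fin (nF G)
    X-closed : isOpen G X ≡ false
    v : Fin 4 → Fin (nV G)
    v-inj : ∀ i j → v i ≡ v j → i ≡ j
    e : Fin 4 → Fin (nE G)
    e-inj : ∀ i j → e i ≡ e j → i ≡ j
    e-ends : ∀ k → SameEnds (src G (e k)) (tgt G (e k)) (v k) (v (next4 k))
    F : Fin 4 → Fin (nF G)
    F-inj : ∀ i j → F i ≡ F j → i ≡ j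
    e-faces : ∀ k → SameEnds (faceOf G (e k , false)) (faceOf G (e k , true)) X (F k)
    X-boundary : ∀ d → faceOf G d ≡ X → ∃[ k ] proj₁ d ≡ e k

open SquareFace

-- edges of G': old edges of G, g_k = v_k u_k, s_k = u_k u_{k+1}
data EClass (n : ℕ) : Set where
  old : Fin n → EClass n
  gE  : Fin 4 → EClass n
  sE  : Fin 4 → EClass n

module _ (G : GraphWithOpenFaces) (S : SquareFace G) where

  NewEdge : EClass (nE G) → Set
  NewEdge (old a) = ¬ (∃[ k ] a ≡ e S k)
  NewEdge (gE k)  = ⊤
  NewEdge (sE k)  = ⊤

  -- faces of G': old faces except X, and the new face X' (= inj₂ tt)
  NewFace : Fin (nF G) ⊎ ⊤ → Set
  NewFace (inj₁ f) = f ≢ X S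
  NewFace (inj₂ _) = ⊤

  -- endpoints (vertices of G' are old vertices ⊎ u_k)
  endL endR : EClass (nE G) → Fin (nV G) ⊎ Fin 4
  endL (old a) = inj₁ (src G a)
  endL (gE k)  = inj₁ (v S k)
  endL (sE k)  = inj₂ k
  endR (old a) = inj₁ (tgt G a)
  endR (gE k)  = inj₂ k
  endR (sE k)  = inj₂ (next4 k)

  faceL faceR : EClass (nE G) → Fin (nF G) ⊎ ⊤
  faceL (old a) = inj₁ (faceOf G (a , false))
  faceL (gE k)  = inj₁ (F S (prev4 k))
  faceL (sE k)  = inj₁ (F S k)
  faceR (old a) = inj₁ (faceOf G (a , true))
  faceR (gE k)  = inj₁ (F S k)
  faceR (sE k)  = inj₂ tt

record Renewal (G : GraphWithOpenFaces) (S : SquareFace G)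
               (G' : GraphWithOpenFaces) : Set where
  field
    clsV : Fin (nV G') → Fin (nV G) ⊎ Fin 4
    clsV-inj : ∀ a b → clsV a ≡ clsV b → a ≡ b
    clsV-surj : ∀ w → ∃[ a ] clsV a ≡ w
    clsE : Fin (nE G') → EClass (nE G)
    clsE-inj : ∀ a b → clsE a ≡ clsE b → a ≡ b
    clsE-img : ∀ a → NewEdge G S (clsE a)
    clsE-surj : ∀ c → NewEdge G S c → ∃[ a ] clsE a ≡ c
    clsF : Fin (nF G') → Fin (nF G) ⊎ ⊤
    clsF-inj : ∀ a b → clsF a ≡ clsF b → a ≡ b
    clsF-img : ∀ a → NewFace G S (clsF a)
    clsF-surj : ∀ c → NewFace G S c → ∃[ a ] clsF a ≡ c
    ends : ∀ a → SameEnds (clsV (src G' a)) (clsV (tgt G' a))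
                          (endL G S (clsE a)) (endR G S (clsE a))
    faces : ∀ a → SameEnds (clsF (faceOf G' (a , false))) (clsF (faceOf G' (a , true)))
                           (faceL G S (clsE a)) (faceR G S (clsE a))
    open-old : ∀ a f → clsF a ≡ inj₁ f → isOpen G' a ≡ isOpen G f
    open-new : ∀ a → clsF a ≡ inj₂ tt → isOpen G' a ≡ false

open Renewal

module NewVars {c ℓ : Level} (R : CommutativeRing c ℓ)
               (G : GraphWithOpenFaces) (S : SquareFace G)
               (G' : GraphWithOpenFaces) (T : Renewal G S G')
               (x xi : Fin (nF G) → CommutativeRing.Carrier R)
               (y : Fin (nE G) → CommutativeRing.Carrier R) where
  open CommutativeRing R using (Carrier; _+_; _*_; 0#; 1#)

  i0 i1 i2 i3 : Fin 4
  i0 = zero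
  i1 = suc zero
  i2 = suc (suc zero)
  i3 = suc (suc (suc zero))

  xX' : Carrier
  xX' = (y (e S i0) * y (e S i2) * x (F S i1) * x (F S i3)
         + y (e S i1) * y (e S i3) * x (F S i0) * x (F S i2)) * xi (X S)

  newX : Fin (nF G') → Carrier
  newX a with clsF T a
  ... | inj₁ f = x f
  ... | inj₂ _ = xX'

  -- inverses, z being the inverse of x_{X'}
  newXi : Carrier → Fin (nF G') → Carrier
  newXi z a with clsF T a
  ... | inj₁ f = xi f
  ... | inj₂ _ = z

  newY : Fin (nE G') → Carrier
  newY a with clsE T a
  ... | old b = y b
  ... | gE k  = 1#
  ... | sE k  = y (e S (next4 (next4 k)))

-- Fix the part σ of a matching that avoids the square.  What remains to be chosen lives
-- on the square (the edges e_k in G, the edges g_k and s_k in G′), and whether a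
-- completion is a perfect matching depends on σ only through the set of corners v_k that
-- σ already covers.  The face exponents split in the same way, so every matching monomial
-- is a weight determined by σ times a local term, and both m(G) and m(G′) are sums over σ
-- of that weight times the local sum for the covered corners.  These local sums agree for
-- each of the sixteen patterns of covered corners (up to the common factor coming from σ):
--  * no corner covered: the two perfect matchings of the square give
--    (y₁y₃x_{F₂}x_{F₄} + y₂y₄x_{F₁}x_{F₃})/x_X, which is x_{X′}, the contribution of the
--    unique completion in G′ (all g_k);
--  * all corners covered: the empty completion in G gives x_X·x_{F₁}x_{F₂}x_{F₃}x_{F₄}, and
--    the two matchings {s₁,s₃}, {s₂,s₄} of G′ give
--    (y₁y₃x_{F₂}x_{F₄} + y₂y₄x_{F₁}x_{F₃})·x_{F₁}x_{F₂}x_{F₃}x_{F₄}/x_{X′}, the same by the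
--    choice of x_{X′};
--  * two adjacent uncovered corners: one completion on each side, with equal monomials;
--  * any other pattern: no completion on either side.

module Submission where

open import Defs
open import Level using (Level)
open import Data.Fin using (Fin)
open import Algebra.Bundles using (CommutativeRing)
open GraphWithOpenFaces using (nF; nE)

open import Data.Bool using (Bool; true; false; not; _∧_; _∨_; _xor_; if_then_else_; T)
import Data.Bool.Properties as Boolₚ
open import Data.Empty using (⊥-elim)
open import Data.Fin using (zero; suc)
open import Data.Fin.Patterns using (0F; 1F; 2F; 3F)
import Data.Fin.Properties as Finₚ
open import Data.Integer as ℤ using (ℤ; +_; -[1+_])
import Data.Integer.Properties as ℤₚ
import Data.Integer.Tactic.RingSolver as ℤ-Solver
open import Data.List using (List; []; _∷_; _++_; map; foldr; tabulate; filter) renaming (allFin to finList)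
open import Data.List.Membership.Propositional using (_∈_; _∉_)
open import Data.List.Membership.Propositional.Properties
  using (∈-map⁻; ∈-map⁺; ∈-allFin; ∈-filter⁺; ∈-filter⁻; ∈-++⁺ˡ; ∈-++⁺ʳ; ∈-++⁻)
open import Data.List.Membership.Propositional.Properties.WithK using (unique∧set⇒bag)
open import Data.List.Properties using (map-tabulate; map-cong; map-cong-local; map-++; map-∘; tabulate-cong)
open import Data.List.Relation.Binary.BagAndSetEquality using (∼bag⇒↭)
open import Data.List.Relation.Binary.Permutation.Propositional as ↭ using (_↭_)
import Data.List.Relation.Binary.Permutation.Propositional.Properties as ↭ₚ
import Data.List.Relation.Unary.All as All
open import Data.List.Relation.Unary.All.Properties using (¬Any⇒All¬)
open import Data.List.Relation.Unary.AllPairs using (_∷_)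
open import Data.List.Relation.Unary.Any using (here; there)
open import Data.List.Relation.Unary.Unique.Propositional using (Unique)
import Data.List.Relation.Unary.Unique.Propositional.Properties as Uniqueₚ
open import Data.Maybe using (Maybe; just; nothing)
open import Data.Nat as ℕ using (ℕ; zero; suc; ⌈_/2⌉; ⌊_/2⌋)
open import Data.Nat.ListAction using (sum)
import Data.Nat.ListAction.Properties as Sumₚ
import Data.Nat.Properties as ℕₚ
import Data.Nat.Tactic.RingSolver as ℕ-Solver
open import Data.Product using (_,_; _×_; ∃-syntax; proj₁; proj₂)
open import Data.Product.Function.NonDependent.Propositional using (_×-⇔_)
open import Data.Sum using (_⊎_; inj₁; inj₂; [_,_]′)
import Data.Sum.Properties as ⊎ₚ
open import Data.Unit using (⊤; tt)
import Data.Unit.Properties as ⊤ₚ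
open import Function using (_∘_; case_of_)
open import Function.Bundles using (_⇔_; mk⇔; Equivalence)
open import Function.Definitions using (Injective)
import Function.Properties.Equivalence as ⇔
open import Function.Related.Propositional using (module EquationalReasoning)
open import Relation.Binary.Definitions using (DecidableEquality)
open import Relation.Binary.PropositionalEquality as ≡ using (_≡_; _≢_; _≗_)
open import Relation.Nullary using (¬_; ¬?; does; yes; no)
open import Relation.Nullary.Decidable using (dec-true; dec-false; map′; _⊎-dec_)
open import Relation.Unary using (Decidable)

Assignment : Set → Set
Assignment A = A → Bool

AgreeOff : ∀ {A : Set} → List A → Assignment A → Assignment A → Set
AgreeOff as τ σ = ∀ a → a ∉ as → τ a ≡ σ a

does-injective : ∀ {A B : Set} (_≟A_ : DecidableEquality A) (_≟B_ : DecidableEquality B) (h : A → B) →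
                 Injective _≡_ _≡_ h → ∀ a c → does (h a ≟B h c) ≡ does (a ≟A c)
does-injective _≟A_ _≟B_ h h-inj a c with a ≟A c
... | yes ≡.refl = dec-true (h a ≟B h a) ≡.refl
... | no a≢c     = dec-false (h a ≟B h c) (a≢c ∘ h-inj)

module Update {A : Set} (_≟_ : DecidableEquality A) where

  infixl 6 _[_≔_]
  _[_≔_] : Assignment A → A → Bool → Assignment A
  (σ [ a ≔ b ]) c = if does (a ≟ c) then b else σ c

  []≔-updates : ∀ σ a b → (σ [ a ≔ b ]) a ≡ b
  []≔-updates σ a b rewrite dec-true (a ≟ a) ≡.refl = ≡.refl

  []≔-minimal : ∀ σ {a c} b → a ≢ c → (σ [ a ≔ b ]) c ≡ σ c
  []≔-minimal σ {a} {c} b a≢c rewrite dec-false (a ≟ c) a≢c = ≡.refl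

  []≔-cong : ∀ {σ τ} a b → σ ≗ τ → σ [ a ≔ b ] ≗ τ [ a ≔ b ]
  []≔-cong a b σ≗τ c with does (a ≟ c)
  ... | true  = ≡.refl
  ... | false = σ≗τ c

  []≔-commutes : ∀ σ {a a′} b b′ → a ≢ a′ → σ [ a ≔ b ] [ a′ ≔ b′ ] ≗ σ [ a′ ≔ b′ ] [ a ≔ b ]
  []≔-commutes σ {a} {a′} b b′ a≢a′ c with a ≟ c | a′ ≟ c
  ... | yes ≡.refl | yes ≡.refl = ⊥-elim (a≢a′ ≡.refl)
  ... | yes _      | no _       = ≡.refl
  ... | no _       | yes _      = ≡.refl
  ... | no _       | no _       = ≡.refl

module AssignmentSum {c} {C : Set c} (_⊕_ : C → C → C) {A : Set} (_≟_ : DecidableEquality A) where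
  open Update _≟_

  ∑ : List A → Assignment A → (Assignment A → C) → C
  ∑ []       σ F = F σ
  ∑ (a ∷ as) σ F = ∑ as (σ [ a ≔ false ]) F ⊕ ∑ as (σ [ a ≔ true ]) F

module AssignmentSumProperties {c ℓ} (R : CommutativeRing c ℓ) where
  open CommutativeRing R hiding (zero)
  open import Algebra.Properties.CommutativeSemigroup +-commutativeSemigroup using (interchange)
  open import Relation.Binary.Reasoning.Setoid setoid

  Respects≗ : ∀ {A : Set} → (Assignment A → Carrier) → Set _
  Respects≗ F = ∀ {σ τ} → σ ≗ τ → F σ ≈ F τ

  module _ {A : Set} (_≟_ : DecidableEquality A) where
    open Update _≟_
    open AssignmentSum _+_ _≟_

    ∑-cong-≗ : ∀ as {σ τ} F → Respects≗ F → σ ≗ τ → ∑ as σ F ≈ ∑ as τ F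
    ∑-cong-≗ []       F F-resp σ≗τ = F-resp σ≗τ
    ∑-cong-≗ (a ∷ as) F F-resp σ≗τ =
      +-cong (∑-cong-≗ as F F-resp ([]≔-cong a false σ≗τ)) (∑-cong-≗ as F F-resp ([]≔-cong a true σ≗τ))

    ∑-cong : ∀ as σ {F G} → (∀ τ → AgreeOff as τ σ → F τ ≈ G τ) → ∑ as σ F ≈ ∑ as σ G
    ∑-cong []       σ F≈G = F≈G σ (λ _ _ → ≡.refl)
    ∑-cong (a ∷ as) σ F≈G = +-cong (∑-cong as _ (restrict false)) (∑-cong as _ (restrict true))
      where
      restrict : ∀ b τ → AgreeOff as τ (σ [ a ≔ b ]) → _
      restrict b τ agree = F≈G τ λ c c∉ →
        ≡.trans (agree c (c∉ ∘ there)) ([]≔-minimal σ b λ { ≡.refl → c∉ (here ≡.refl) })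

    ∑-++ : ∀ as bs σ F → ∑ (as ++ bs) σ F ≈ ∑ as σ (λ τ → ∑ bs τ F)
    ∑-++ []       bs σ F = refl
    ∑-++ (a ∷ as) bs σ F = +-cong (∑-++ as bs _ F) (∑-++ as bs _ F)

    ∑-zero : ∀ as σ → ∑ as σ (λ _ → 0#) ≈ 0#
    ∑-zero []       σ = refl
    ∑-zero (a ∷ as) σ = trans (+-cong (∑-zero as _) (∑-zero as _)) (+-identityˡ 0#)

    ∑-*ˡ : ∀ as σ k F → ∑ as σ (λ τ → k * F τ) ≈ k * ∑ as σ F
    ∑-*ˡ []       σ k F = refl
    ∑-*ˡ (a ∷ as) σ k F = trans (+-cong (∑-*ˡ as _ k F) (∑-*ˡ as _ k F)) (sym (distribˡ k _ _))

    ∑-↭ : ∀ {as bs} → as ↭ bs → ∀ σ F → Respects≗ F → ∑ as σ F ≈ ∑ bs σ F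
    ∑-↭ ↭.refl         σ F F-resp = refl
    ∑-↭ (↭.prep a p)   σ F F-resp = +-cong (∑-↭ p _ F F-resp) (∑-↭ p _ F F-resp)
    ∑-↭ (↭.trans p q)  σ F F-resp = trans (∑-↭ p σ F F-resp) (∑-↭ q σ F F-resp)
    ∑-↭ (↭.swap {xs} {ys} a a′ p) σ F F-resp with a ≟ a′
    ... | yes ≡.refl = +-cong (+-cong (swapped false false) (swapped false true))
                              (+-cong (swapped true false) (swapped true true))
      where
      swapped : ∀ b b′ → ∑ xs (σ [ a ≔ b ] [ a ≔ b′ ]) F ≈ ∑ ys (σ [ a ≔ b ] [ a ≔ b′ ]) F
      swapped b b′ = ∑-↭ p _ F F-resp
    ... | no a≢a′ = trans (interchange _ _ _ _)
                          (+-cong (+-cong (swapped false false) (swapped true false))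
                                  (+-cong (swapped false true) (swapped true true)))
      where
      swapped : ∀ b b′ → ∑ xs (σ [ a ≔ b ] [ a′ ≔ b′ ]) F ≈ ∑ ys (σ [ a′ ≔ b′ ] [ a ≔ b ]) F
      swapped b b′ = trans (∑-cong-≗ xs F F-resp ([]≔-commutes σ b b′ a≢a′)) (∑-↭ p _ F F-resp)

  module _ {A B : Set} (_≟A_ : DecidableEquality A) (_≟B_ : DecidableEquality B)
           (h : A → B) (h-inj : Injective _≡_ _≡_ h) where
    private
      module A = AssignmentSum _+_ _≟A_
      module B = AssignmentSum _+_ _≟B_
      module UA = Update _≟A_
      module UB = Update _≟B_

    ∑-map : ∀ as σ τ {F G} → (∀ a → τ a ≡ σ (h a)) →
            (∀ σ′ τ′ → AgreeOff (map h as) σ′ σ → (∀ a → τ′ a ≡ σ′ (h a)) → F σ′ ≈ G τ′) →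
            B.∑ (map h as) σ F ≈ A.∑ as τ G
    ∑-map []       σ τ τ≗ F≈G = F≈G σ τ (λ _ _ → ≡.refl) τ≗
    ∑-map (a ∷ as) σ τ {F} {G} τ≗ F≈G = +-cong (step false) (step true)
      where
      step : ∀ b → B.∑ (map h as) (σ UB.[ h a ≔ b ]) F ≈ A.∑ as (τ UA.[ a ≔ b ]) G
      step b = ∑-map as _ _ τ≗′ F≈G′
        where
        τ≗′ : ∀ a′ → (τ UA.[ a ≔ b ]) a′ ≡ (σ UB.[ h a ≔ b ]) (h a′)
        τ≗′ a′ rewrite does-injective _≟A_ _≟B_ h h-inj a a′ with does (a ≟A a′)
        ... | true  = ≡.refl
        ... | false = τ≗ a′
        F≈G′ : ∀ σ′ τ′ → AgreeOff (map h as) σ′ (σ UB.[ h a ≔ b ]) → (∀ a → τ′ a ≡ σ′ (h a)) → F σ′ ≈ G τ′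
        F≈G′ σ′ τ′ agree = F≈G σ′ τ′ λ c c∉ →
          ≡.trans (agree c (c∉ ∘ there)) (UB.[]≔-minimal σ b λ { ≡.refl → c∉ (here ≡.refl) })

  module _ {C : Set c} (_⊕_ : C → C → C) (f : C → Carrier) (f-homo : ∀ p q → f (p ⊕ q) ≈ f p + f q)
           {A : Set} (_≟_ : DecidableEquality A) where
    private
      module ⊕ = AssignmentSum _⊕_ _≟_
      module + = AssignmentSum _+_ _≟_

    ∑-homo : ∀ as σ F → f (⊕.∑ as σ F) ≈ +.∑ as σ (f ∘ F)
    ∑-homo []       σ F = refl
    ∑-homo (a ∷ as) σ F = trans (f-homo _ _) (+-cong (∑-homo as _ F) (∑-homo as _ F))

  subsetSum : (n : ℕ) → (Assignment (Fin n) → Carrier) → Carrier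
  subsetSum n F = foldr (λ M acc → F M + acc) 0# (allSubsets n)

  private
    foldrSum : ∀ {X : Set} → (X → Carrier) → List X → Carrier
    foldrSum F = foldr (λ M acc → F M + acc) 0#

    foldrSum-++ : ∀ {X : Set} (F : X → Carrier) xs ys → foldrSum F (xs ++ ys) ≈ foldrSum F xs + foldrSum F ys
    foldrSum-++ F []       ys = sym (+-identityˡ _)
    foldrSum-++ F (x ∷ xs) ys = trans (+-congˡ (foldrSum-++ F xs ys)) (sym (+-assoc _ _ _))

    foldrSum-map : ∀ {X Y : Set} (F : Y → Carrier) (g : X → Y) xs → foldrSum F (map g xs) ≡ foldrSum (F ∘ g) xs
    foldrSum-map F g []       = ≡.refl
    foldrSum-map F g (x ∷ xs) = ≡.cong (_+_ (F (g x))) (foldrSum-map F g xs)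

    consB-cong : ∀ {n} b {σ τ : Assignment (Fin n)} → σ ≗ τ → consB b σ ≗ consB b τ
    consB-cong b σ≗τ zero    = ≡.refl
    consB-cong b σ≗τ (suc i) = σ≗τ i

  open AssignmentSum _+_ using (∑)

  subsetSum≈∑ : ∀ n F → Respects≗ F → ∀ σ → subsetSum n F ≈ ∑ Finₚ._≟_ (finList n) σ F
  subsetSum≈∑ zero    F F-resp σ = trans (+-identityʳ _) (F-resp λ ())
  subsetSum≈∑ (suc n) F F-resp σ = begin
    subsetSum (suc n) F
      ≈⟨ foldrSum-++ F (map (consB false) (allSubsets n)) (map (consB true) (allSubsets n)) ⟩
    foldrSum F (map (consB false) (allSubsets n)) + foldrSum F (map (consB true) (allSubsets n))
      ≡⟨ ≡.cong₂ _+_ (foldrSum-map F (consB false) (allSubsets n)) (foldrSum-map F (consB true) (allSubsets n)) ⟩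
    subsetSum n (F ∘ consB false) + subsetSum n (F ∘ consB true)
      ≈⟨ +-cong (fixFirst false) (fixFirst true) ⟩
    ∑ Finₚ._≟_ (finList (suc n)) σ F ∎
    where
    open Update (Finₚ._≟_ {suc n}) using (_[_≔_]; []≔-updates)
    fixFirst : ∀ b → subsetSum n (F ∘ consB b) ≈ ∑ Finₚ._≟_ (tabulate suc) (σ [ zero ≔ b ]) F
    fixFirst b = begin
      subsetSum n (F ∘ consB b)
        ≈⟨ subsetSum≈∑ n (F ∘ consB b) (F-resp ∘ consB-cong b) (λ i → (σ [ zero ≔ b ]) (suc i)) ⟩
      ∑ Finₚ._≟_ (finList n) (λ i → (σ [ zero ≔ b ]) (suc i)) (F ∘ consB b)
        ≈⟨ sym (∑-map Finₚ._≟_ Finₚ._≟_ suc Finₚ.suc-injective (finList n) _ _ (λ _ → ≡.refl) agree) ⟩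
      ∑ Finₚ._≟_ (map suc (finList n)) (σ [ zero ≔ b ]) F
        ≡⟨ ≡.cong (λ is → ∑ Finₚ._≟_ is (σ [ zero ≔ b ]) F) (map-tabulate (λ i → i) suc) ⟩
      ∑ Finₚ._≟_ (tabulate suc) (σ [ zero ≔ b ]) F ∎
      where
      zero∉ : zero ∉ map suc (finList n)
      zero∉ m with ∈-map⁻ suc m
      ... | _ , _ , ()
      agree : ∀ σ′ τ′ → AgreeOff (map suc (finList n)) σ′ (σ [ zero ≔ b ]) → (∀ i → τ′ i ≡ σ′ (suc i)) → F σ′ ≈ F (consB b τ′)
      agree σ′ τ′ σ′-agree τ′≗ = F-resp λ where
        zero    → ≡.trans (σ′-agree zero zero∉) ([]≔-updates σ zero b)
        (suc i) → ≡.sym (τ′≗ i)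

𝟙 : Bool → ℕ
𝟙 true  = 1
𝟙 false = 0

faceExponent : Bool → ℤ → ℤ
faceExponent true  n = ceilHalf n
faceExponent false n = ceilHalf n ℤ.- + 1

epsilon≡faceExponent : ∀ H M f →
  epsilon H M f ≡ faceExponent (GraphWithOpenFaces.isOpen H f) (+ betaF H M f ℤ.- + alphaF H M f)
epsilon≡faceExponent H M f with GraphWithOpenFaces.isOpen H f
... | true  = ≡.refl
... | false = ≡.refl

ceilHalf-+2 : ∀ n → ceilHalf (n ℤ.+ + 2) ≡ ceilHalf n ℤ.+ + 1
ceilHalf-+2 (+ n) = ≡.trans (≡.cong (λ m → + ⌈ m /2⌉) (ℕₚ.+-comm n 2)) (≡.cong +_ (ℕₚ.+-comm 1 ⌈ n /2⌉))
ceilHalf-+2 -[1+ zero ]          = ≡.refl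
ceilHalf-+2 -[1+ suc zero ]      = ≡.refl
ceilHalf-+2 -[1+ suc (suc n) ]   = ≡.sym (-suc+1 ⌊ suc n /2⌋)
  where
  -suc+1 : ∀ k → ℤ.- (+ suc k) ℤ.+ + 1 ≡ ℤ.- (+ k)
  -suc+1 zero    = ≡.refl
  -suc+1 (suc k) = ≡.refl

faceExponent-+2 : ∀ o n → faceExponent o (n ℤ.+ + 2) ≡ faceExponent o n ℤ.+ + 1
faceExponent-+2 true  n = ceilHalf-+2 n
faceExponent-+2 false n = ≡.trans (≡.cong (ℤ._- + 1) (ceilHalf-+2 n)) (shift (ceilHalf n))
  where
  shift : ∀ c → (c ℤ.+ + 1) ℤ.- + 1 ≡ (c ℤ.- + 1) ℤ.+ + 1
  shift = ℤ-Solver.solve-∀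

diff-split : ∀ u m B A → + (u ℕ.+ B) ℤ.- + (m ℕ.+ A) ≡ (+ B ℤ.- + A) ℤ.+ (+ u ℤ.- + m)
diff-split u m B A = ≡.trans (≡.cong₂ ℤ._-_ (ℤₚ.pos-+ u B) (ℤₚ.pos-+ m A)) (rearrange (+ u) (+ m) (+ B) (+ A))
  where
  rearrange : ∀ u m B A → (u ℤ.+ B) ℤ.- (m ℤ.+ A) ≡ (B ℤ.- A) ℤ.+ (u ℤ.- m)
  rearrange = ℤ-Solver.solve-∀

module FaceWeights {c ℓ} (R : CommutativeRing c ℓ) where
  open CommutativeRing R hiding (zero)
  open Eval R using (powZ)
  open import Relation.Binary.Reasoning.Setoid setoid

  oneEdgeFactor : Bool → Carrier → Carrier → Carrier
  oneEdgeFactor true  x P = P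
  oneEdgeFactor false x P = x * P

  threeEdgeFactor : Bool → Bool → Bool → Carrier → Carrier → Carrier → Carrier
  threeEdgeFactor false false false x xi P = x * (x * P)
  threeEdgeFactor true  false false x xi P = x * P
  threeEdgeFactor false true  false x xi P = x * P
  threeEdgeFactor false false true  x xi P = x * P
  threeEdgeFactor true  true  false x xi P = P
  threeEdgeFactor true  false true  x xi P = P
  threeEdgeFactor false true  true  x xi P = P
  threeEdgeFactor true  true  true  x xi P = xi * P

  faceWeight : Carrier → Carrier → Bool → ℤ → Carrier
  faceWeight x xi o n = powZ x xi (faceExponent o n)

  module _ (x xi : Carrier) (x*xi≈1 : x * xi ≈ 1#) where

    powZ-+1 : ∀ w → powZ x xi (w ℤ.+ + 1) ≈ x * powZ x xi w
    powZ-+1 (+ n) rewrite ℕₚ.+-comm n 1 = refl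
    powZ-+1 -[1+ zero ]  = sym x*xi≈1
    powZ-+1 -[1+ suc n ] = begin
      powZ x xi -[1+ n ]            ≈⟨ sym (*-identityˡ _) ⟩
      1# * powZ x xi -[1+ n ]       ≈⟨ *-congʳ (sym x*xi≈1) ⟩
      (x * xi) * powZ x xi -[1+ n ] ≈⟨ *-assoc x xi _ ⟩
      x * (xi * powZ x xi -[1+ n ]) ∎

    faceWeight-≡ : ∀ o {n n′} → n ≡ n′ → faceWeight x xi o n ≈ faceWeight x xi o n′
    faceWeight-≡ o eq = reflexive (≡.cong (faceWeight x xi o) eq)

    faceWeight-+2 : ∀ o n → faceWeight x xi o (n ℤ.+ + 2) ≈ x * faceWeight x xi o n
    faceWeight-+2 o n = trans (reflexive (≡.cong (powZ x xi) (faceExponent-+2 o n))) (powZ-+1 (faceExponent o n))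

    faceWeight-−2 : ∀ o n → faceWeight x xi o (n ℤ.- + 2) ≈ xi * faceWeight x xi o n
    faceWeight-−2 o n = begin
      faceWeight x xi o (n ℤ.- + 2)                  ≈⟨ sym (*-identityˡ _) ⟩
      1# * faceWeight x xi o (n ℤ.- + 2)             ≈⟨ *-congʳ (sym (trans (*-comm xi x) x*xi≈1)) ⟩
      (xi * x) * faceWeight x xi o (n ℤ.- + 2)       ≈⟨ *-assoc xi x _ ⟩
      xi * (x * faceWeight x xi o (n ℤ.- + 2))       ≈⟨ *-congˡ (sym (faceWeight-+2 o _)) ⟩
      xi * faceWeight x xi o ((n ℤ.- + 2) ℤ.+ + 2)   ≈⟨ *-congˡ (faceWeight-≡ o (cancel n)) ⟩
      xi * faceWeight x xi o n                       ∎
      where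
      cancel : ∀ n → (n ℤ.- + 2) ℤ.+ + 2 ≡ n
      cancel = ℤ-Solver.solve-∀

    private
      shift₁ : ∀ δ → δ ℤ.+ (+ 1 ℤ.- + 0) ≡ (δ ℤ.- + 1) ℤ.+ + 2
      shift₁ = ℤ-Solver.solve-∀
      shift₋₁ : ∀ δ → δ ℤ.+ (+ 0 ℤ.- + 1) ≡ δ ℤ.- + 1
      shift₋₁ = ℤ-Solver.solve-∀
      shift₃ : ∀ δ → δ ℤ.+ (+ 3 ℤ.- + 0) ≡ ((δ ℤ.- + 1) ℤ.+ + 2) ℤ.+ + 2
      shift₃ = ℤ-Solver.solve-∀
      shift₁′ : ∀ δ → δ ℤ.+ (+ 2 ℤ.- + 1) ≡ (δ ℤ.- + 1) ℤ.+ + 2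
      shift₁′ = ℤ-Solver.solve-∀
      shift₋₁′ : ∀ δ → δ ℤ.+ (+ 1 ℤ.- + 2) ≡ δ ℤ.- + 1
      shift₋₁′ = ℤ-Solver.solve-∀
      shift₋₃ : ∀ δ → δ ℤ.+ (+ 0 ℤ.- + 3) ≡ (δ ℤ.- + 1) ℤ.- + 2
      shift₋₃ = ℤ-Solver.solve-∀

    oneEdge-faceWeight : ∀ o B A b →
      faceWeight x xi o (+ (𝟙 (not b) ℕ.+ B) ℤ.- + (𝟙 b ℕ.+ A)) ≈
      oneEdgeFactor b x (faceWeight x xi o ((+ B ℤ.- + A) ℤ.- + 1))
    oneEdge-faceWeight o B A b = trans (faceWeight-≡ o (diff-split (𝟙 (not b)) (𝟙 b) B A)) (shifted b)
      where
      δ = + B ℤ.- + A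
      shifted : ∀ b → faceWeight x xi o (δ ℤ.+ (+ 𝟙 (not b) ℤ.- + 𝟙 b)) ≈ oneEdgeFactor b x (faceWeight x xi o (δ ℤ.- + 1))
      shifted true  = faceWeight-≡ o (shift₋₁ δ)
      shifted false = trans (faceWeight-≡ o (shift₁ δ)) (faceWeight-+2 o _)

    threeEdge-faceWeight : ∀ o B A a b c →
      faceWeight x xi o (+ ((𝟙 (not a) ℕ.+ (𝟙 (not b) ℕ.+ 𝟙 (not c))) ℕ.+ B) ℤ.- + ((𝟙 a ℕ.+ (𝟙 b ℕ.+ 𝟙 c)) ℕ.+ A)) ≈
      threeEdgeFactor a b c x xi (faceWeight x xi o ((+ B ℤ.- + A) ℤ.- + 1))
    threeEdge-faceWeight o B A a b c =
      trans (faceWeight-≡ o (diff-split (𝟙 (not a) ℕ.+ (𝟙 (not b) ℕ.+ 𝟙 (not c))) (𝟙 a ℕ.+ (𝟙 b ℕ.+ 𝟙 c)) B A)) (shifted a b c)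
      where
      δ = + B ℤ.- + A
      P = faceWeight x xi o (δ ℤ.- + 1)
      none : faceWeight x xi o (δ ℤ.+ (+ 3 ℤ.- + 0)) ≈ x * (x * P)
      none = trans (faceWeight-≡ o (shift₃ δ)) (trans (faceWeight-+2 o _) (*-congˡ (faceWeight-+2 o _)))
      one : faceWeight x xi o (δ ℤ.+ (+ 2 ℤ.- + 1)) ≈ x * P
      one = trans (faceWeight-≡ o (shift₁′ δ)) (faceWeight-+2 o _)
      two : faceWeight x xi o (δ ℤ.+ (+ 1 ℤ.- + 2)) ≈ P
      two = faceWeight-≡ o (shift₋₁′ δ)
      three : faceWeight x xi o (δ ℤ.+ (+ 0 ℤ.- + 3)) ≈ xi * P
      three = trans (faceWeight-≡ o (shift₋₃ δ)) (faceWeight-−2 o _)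
      shifted : ∀ a b c → faceWeight x xi o (δ ℤ.+ (+ (𝟙 (not a) ℕ.+ (𝟙 (not b) ℕ.+ 𝟙 (not c))) ℤ.- + (𝟙 a ℕ.+ (𝟙 b ℕ.+ 𝟙 c))))
                        ≈ threeEdgeFactor a b c x xi P
      shifted false false false = none
      shifted true  false false = one
      shifted false true  false = one
      shifted false false true  = one
      shifted true  true  false = two
      shifted true  false true  = two
      shifted false true  true  = two
      shifted true  true  true  = three

countFin-cong : ∀ n {p q : Fin n → Bool} → p ≗ q → countFin n p ≡ countFin n q
countFin-cong zero    p≗q = ≡.refl
countFin-cong (suc n) p≗q = ≡.cong₂ ℕ._+_ (≡.cong (λ b → if b then 1 else 0) (p≗q zero)) (countFin-cong n (p≗q ∘ suc))

allFin-cong : ∀ n {p q : Fin n → Bool} → p ≗ q → allFin n p ≡ allFin n q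
allFin-cong zero    p≗q = ≡.refl
allFin-cong (suc n) p≗q = ≡.cong₂ _∧_ (p≗q zero) (allFin-cong n (p≗q ∘ suc))

module _ (H : GraphWithOpenFaces) where
  open GraphWithOpenFaces H using (nV; faceOf)

  isMatching-cong : ∀ {M M′} → M ≗ M′ → isMatching H M ≡ isMatching H M′
  isMatching-cong M≗M′ = allFin-cong nV λ w →
    ≡.cong (ℕ._≡ᵇ 1) (countFin-cong (nE H) λ a → ≡.cong (_∧ incident H a w) (M≗M′ a))

  epsilon-cong : ∀ {M M′} → M ≗ M′ → ∀ f → epsilon H M f ≡ epsilon H M′ f
  epsilon-cong {M} {M′} M≗M′ f = ≡.trans (epsilon≡faceExponent H M f)
    (≡.trans (≡.cong (faceExponent (GraphWithOpenFaces.isOpen H f)) (≡.cong₂ (λ m n → + m ℤ.- + n) (count-cong not) (count-cong (λ b → b))))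
             (≡.sym (epsilon≡faceExponent H M′ f)))
    where
    count-cong : ∀ q → countDart (nE H) (λ d → does (faceOf d Finₚ.≟ f) ∧ q (M (proj₁ d))) ≡
                       countDart (nE H) (λ d → does (faceOf d Finₚ.≟ f) ∧ q (M′ (proj₁ d)))
    count-cong q = ≡.cong₂ ℕ._+_ (countFin-cong (nE H) (λ a → ≡.cong (λ b → does (faceOf (a , false) Finₚ.≟ f) ∧ q b) (M≗M′ a)))
                                 (countFin-cong (nE H) (λ a → ≡.cong (λ b → does (faceOf (a , true) Finₚ.≟ f) ∧ q b) (M≗M′ a)))

∑⁴ : (Fin 4 → ℕ) → ℕ
∑⁴ f = sum (map f (finList 4))

∑⁴-cong : ∀ {f g} → (∀ k → f k ≡ g k) → ∑⁴ f ≡ ∑⁴ g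
∑⁴-cong f≗g = ≡.cong sum (map-cong f≗g (finList 4))

private
  +0+0 : ∀ n → (n ℕ.+ 0) ℕ.+ 0 ≡ n
  +0+0 n = ≡.trans (ℕₚ.+-identityʳ _) (ℕₚ.+-identityʳ n)

  swap+0 : ∀ m n → m ℕ.+ (n ℕ.+ 0) ≡ n ℕ.+ m
  swap+0 m n = ≡.trans (≡.cong (m ℕ.+_) (ℕₚ.+-identityʳ n)) (ℕₚ.+-comm m n)

∑⁴-select : ∀ j (f : Fin 4 → ℕ) → ∑⁴ (λ k → 𝟙 (does (k Finₚ.≟ j)) ℕ.* f k) ≡ f j
∑⁴-select 0F f = +0+0 (f 0F)
∑⁴-select 1F f = +0+0 (f 1F)
∑⁴-select 2F f = +0+0 (f 2F)
∑⁴-select 3F f = +0+0 (f 3F)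

count : ∀ {n} → (Fin n → Bool) → ℕ
count {n} t = sum (map (𝟙 ∘ t) (finList n))

Values⁴ : Set
Values⁴ = Bool × Bool × Bool × Bool

values : ∀ {t t′ : Fin 4 → Bool} → t ≗ t′ → (t 0F , t 1F , t 2F , t 3F) ≡ (t′ 0F , t′ 1F , t′ 2F , t′ 3F)
values eq = ≡.cong₂ _,_ (eq 0F) (≡.cong₂ _,_ (eq 1F) (≡.cong₂ _,_ (eq 2F) (eq 3F)))

-- A function that inspects t only at the four literals cannot tell t from corners (t 0F , … , t 3F).
corners : Values⁴ → Fin 4 → Bool
corners (a , b , c , e) 0F = a
corners (a , b , c , e) 1F = b
corners (a , b , c , e) 2F = c
corners (a , b , c , e) 3F = e

cornerOK : Bool → Bool → Bool → Bool
cornerOK true  a b = not a ∧ not b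
cornerOK false a b = a xor b

-- d k: the corner v_k is covered by an edge away from the square; t k: e_k = v_k v_{k+1}
-- is matched.
squareOK : (Fin 4 → Bool) → Assignment (Fin 4) → Bool
squareOK d t = cornerOK (d 0F) (t 0F) (t 3F) ∧ (cornerOK (d 1F) (t 1F) (t 0F) ∧
               (cornerOK (d 2F) (t 2F) (t 1F) ∧ cornerOK (d 3F) (t 3F) (t 2F)))

spokeOK : Bool → Bool → Bool
spokeOK true  g = not g
spokeOK false g = g

exactlyOne : Bool → Bool → Bool → Bool
exactlyOne a b c = (𝟙 a ℕ.+ (𝟙 b ℕ.+ 𝟙 c)) ℕ.≡ᵇ 1

-- inj₁ k stands for g_k = v_k u_k and inj₂ k for s_k = u_k u_{k+1}.
spokes rim : Assignment (Fin 4 ⊎ Fin 4) → Fin 4 → Bool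
spokes τ k = τ (inj₁ k)
rim τ k = τ (inj₂ k)

renewedOK : (Fin 4 → Bool) → Assignment (Fin 4 ⊎ Fin 4) → Bool
renewedOK d τ =
  (spokeOK (d 0F) (spokes τ 0F) ∧ (spokeOK (d 1F) (spokes τ 1F) ∧ (spokeOK (d 2F) (spokes τ 2F) ∧ spokeOK (d 3F) (spokes τ 3F)))) ∧
  (exactlyOne (spokes τ 0F) (rim τ 0F) (rim τ 3F) ∧ (exactlyOne (spokes τ 1F) (rim τ 1F) (rim τ 0F) ∧
   (exactlyOne (spokes τ 2F) (rim τ 2F) (rim τ 1F) ∧ exactlyOne (spokes τ 3F) (rim τ 3F) (rim τ 2F))))

renewedIndices : List (Fin 4 ⊎ Fin 4)
renewedIndices = map inj₁ (finList 4) ++ map inj₂ (finList 4)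

T-allFin : ∀ n (p : Fin n → Bool) → T (allFin n p) ⇔ (∀ i → T (p i))
T-allFin zero    p = mk⇔ (λ _ ()) (λ _ → tt)
T-allFin (suc n) p = mk⇔ to from
  where
  to : T (p zero ∧ allFin n (p ∘ suc)) → ∀ i → T (p i)
  to h zero    = proj₁ (Equivalence.to Boolₚ.T-∧ h)
  to h (suc i) = Equivalence.to (T-allFin n (p ∘ suc)) (proj₂ (Equivalence.to Boolₚ.T-∧ h)) i
  from : (∀ i → T (p i)) → T (p zero ∧ allFin n (p ∘ suc))
  from h = Equivalence.from Boolₚ.T-∧ (h zero , Equivalence.from (T-allFin n (p ∘ suc)) (h ∘ suc))

T-∧⁴ : ∀ (p : Fin 4 → Bool) → T (p 0F ∧ (p 1F ∧ (p 2F ∧ p 3F))) ⇔ (∀ j → T (p j))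
T-∧⁴ p = mk⇔ to from
  where
  split : ∀ a {b} → T (a ∧ b) → T a × T b
  split a = Equivalence.to (Boolₚ.T-∧ {a})
  join : ∀ {a b} → T a × T b → T (a ∧ b)
  join = Equivalence.from Boolₚ.T-∧
  to : T (p 0F ∧ (p 1F ∧ (p 2F ∧ p 3F))) → ∀ j → T (p j)
  to h 0F = proj₁ (split (p 0F) h)
  to h 1F = proj₁ (split (p 1F) (proj₂ (split (p 0F) h)))
  to h 2F = proj₁ (split (p 2F) (proj₂ (split (p 1F) (proj₂ (split (p 0F) h)))))
  to h 3F = proj₂ (split (p 2F) (proj₂ (split (p 1F) (proj₂ (split (p 0F) h)))))
  from : (∀ j → T (p j)) → T (p 0F ∧ (p 1F ∧ (p 2F ∧ p 3F)))
  from h = join (h 0F , join (h 1F , join (h 2F , h 3F)))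

cornerCount : ∀ a b c → ((𝟙 a ℕ.+ 𝟙 b) ℕ.+ c ℕ.≡ᵇ 1) ≡ (c ℕ.≤ᵇ 1) ∧ cornerOK (c ℕ.≡ᵇ 1) a b
cornerCount false false 0 = ≡.refl
cornerCount false true  0 = ≡.refl
cornerCount true  false 0 = ≡.refl
cornerCount true  true  0 = ≡.refl
cornerCount false false 1 = ≡.refl
cornerCount false true  1 = ≡.refl
cornerCount true  false 1 = ≡.refl
cornerCount true  true  1 = ≡.refl
cornerCount false false (suc (suc c)) = ≡.refl
cornerCount false true  (suc (suc c)) = ≡.refl
cornerCount true  false (suc (suc c)) = ≡.refl
cornerCount true  true  (suc (suc c)) = ≡.refl

spokeCount : ∀ g c → (𝟙 g ℕ.+ c ℕ.≡ᵇ 1) ≡ (c ℕ.≤ᵇ 1) ∧ spokeOK (c ℕ.≡ᵇ 1) g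
spokeCount false 0             = ≡.refl
spokeCount true  0             = ≡.refl
spokeCount false 1             = ≡.refl
spokeCount true  1             = ≡.refl
spokeCount false (suc (suc c)) = ≡.refl
spokeCount true  (suc (suc c)) = ≡.refl

-- Unlike filterᵇ, whose with-auxiliary receives the predicate itself, keep applies t only
-- to list elements, so that the terms below depend on t only through t 0F, …, t 3F.
keep : ∀ {A : Set} → (A → Bool) → List A → List A
keep t []       = []
keep t (a ∷ as) = if t a then a ∷ keep t as else keep t as

module Products {c ℓ} (R : CommutativeRing c ℓ) where
  open CommutativeRing R hiding (zero)
  open import Relation.Binary.Reasoning.Setoid setoid

  product : List Carrier → Carrier
  product = foldr _*_ 1#

  -- Unlike product, ∏ has no trailing 1#, so local terms compute to the monomials one would
  -- write by hand.
  ∏ : List Carrier → Carrier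
  ∏ []           = 1#
  ∏ (p ∷ [])     = p
  ∏ (p ∷ q ∷ ps) = p * ∏ (q ∷ ps)

  product≈∏ : ∀ ps → product ps ≈ ∏ ps
  product≈∏ []           = refl
  product≈∏ (p ∷ [])     = *-identityʳ p
  product≈∏ (p ∷ q ∷ ps) = *-congˡ (product≈∏ (q ∷ ps))

  product-++ : ∀ ps qs → product (ps ++ qs) ≈ product ps * product qs
  product-++ []       qs = sym (*-identityˡ _)
  product-++ (p ∷ ps) qs = trans (*-congˡ (product-++ ps qs)) (sym (*-assoc _ _ _))

  product-↭ : ∀ {ps qs} → ps ↭ qs → product ps ≈ product qs
  product-↭ p = foldr-commMonoid *-isCommutativeMonoid (↭.↭⇒↭ₛ′ isEquivalence p)
    where open import Data.List.Relation.Binary.Permutation.Setoid.Properties setoid using (foldr-commMonoid)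

  product-map-cong : ∀ {A : Set} (as : List A) {f g : A → Carrier} → (∀ {a} → a ∈ as → f a ≈ g a) → product (map f as) ≈ product (map g as)
  product-map-cong []       f≈g = refl
  product-map-cong (a ∷ as) f≈g = *-cong (f≈g (here ≡.refl)) (product-map-cong as (f≈g ∘ there))

  product-ones : ∀ {A : Set} (as : List A) {f : A → Carrier} → (∀ a → f a ≈ 1#) → product (map f as) ≈ 1#
  product-ones []       ones = refl
  product-ones (a ∷ as) ones = trans (*-cong (ones a) (product-ones as ones)) (*-identityˡ 1#)

  product-selected : ∀ {A : Set} (t : A → Bool) (w : A → Carrier) as →
                     product (map (λ a → if t a then w a else 1#) as) ≈ ∏ (map w (keep t as))
  product-selected t w []       = refl
  product-selected t w (a ∷ as) with t a
  ... | true  = trans (*-congˡ (trans (product-selected t w as) (sym (product≈∏ rest)))) (product≈∏ (w a ∷ rest))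
    where rest = map w (keep t as)
  ... | false = trans (*-identityˡ _) (product-selected t w as)

  prodFin-cong : ∀ n {f g : Fin n → Carrier} → f ≗ g → Eval.prodFin R n f ≡ Eval.prodFin R n g
  prodFin-cong zero    f≗g = ≡.refl
  prodFin-cong (suc n) f≗g = ≡.cong₂ _*_ (f≗g zero) (prodFin-cong n (f≗g ∘ suc))

  prodFin≡product : ∀ n f → Eval.prodFin R n f ≡ product (tabulate f)
  prodFin≡product zero    f = ≡.refl
  prodFin≡product (suc n) f = ≡.cong (f zero *_) (prodFin≡product n (f ∘ suc))

module SquareMove {c ℓ} (R : CommutativeRing c ℓ) where
  open CommutativeRing R hiding (zero)
  open Eval R using (powZ)
  open FaceWeights R using (oneEdgeFactor; threeEdgeFactor)
  open import Algebra.Solver.Ring.NaturalCoefficients.Default commutativeSemiring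
  open import Relation.Binary.Reasoning.Setoid setoid

  open Products R using (∏)

  -- Local sums are computed in Maybe Carrier, where summands that vanish are absent
  -- rather than 0#: for concrete corner patterns they then disappear by computation.
  _⊕_ : Maybe Carrier → Maybe Carrier → Maybe Carrier
  nothing ⊕ m       = m
  just p  ⊕ nothing = just p
  just p  ⊕ just q  = just (p + q)

  val : Maybe Carrier → Carrier
  val nothing  = 0#
  val (just p) = p

  val-⊕ : ∀ m n → val (m ⊕ n) ≈ val m + val n
  val-⊕ nothing  n        = sym (+-identityˡ _)
  val-⊕ (just p) nothing  = sym (+-identityʳ _)
  val-⊕ (just p) (just q) = refl

  when : Bool → Carrier → Maybe Carrier
  when true  p = just p
  when false p = nothing

  module Weights (y x xi P : Fin 4 → Carrier) (xX xiX z : Carrier) where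

    xX′ : Carrier
    xX′ = (y 0F * y 2F * x 1F * x 3F + y 1F * y 3F * x 0F * x 2F) * xiX

    squareTerm : Assignment (Fin 4) → Carrier
    squareTerm t =
      ∏ (map y (keep t (finList 4))) *
      (powZ xX xiX (faceExponent false (+ count (not ∘ t) ℤ.- + count t)) *
       ∏ (map (λ k → oneEdgeFactor (t k) (x k) (P k)) (finList 4)))

    renewedTerm : Assignment (Fin 4 ⊎ Fin 4) → Carrier
    renewedTerm τ =
      ∏ (map (y ∘ next4 ∘ next4) (keep (rim τ) (finList 4))) *
      (powZ xX′ z (faceExponent false (+ count (not ∘ rim τ) ℤ.- + count (rim τ))) *
       ∏ (map (λ k → threeEdgeFactor (spokes τ k) (rim τ k) (spokes τ (next4 k)) (x k) (xi k) (P k)) (finList 4)))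

    open AssignmentSum _⊕_ using (∑)

    squareSummand : (Fin 4 → Bool) → Assignment (Fin 4) → Maybe Carrier
    squareSummand d t = when (squareOK d t) (squareTerm t)

    renewedSummand : (Fin 4 → Bool) → Assignment (Fin 4 ⊎ Fin 4) → Maybe Carrier
    renewedSummand d τ = when (renewedOK d τ) (renewedTerm τ)

    squareSum : (Fin 4 → Bool) → Assignment (Fin 4) → Maybe Carrier
    squareSum d t₀ = ∑ Finₚ._≟_ (finList 4) t₀ (squareSummand d)

    renewedSum : (Fin 4 → Bool) → Assignment (Fin 4 ⊎ Fin 4) → Maybe Carrier
    renewedSum d τ₀ = ∑ (⊎ₚ.≡-dec Finₚ._≟_ Finₚ._≟_) renewedIndices τ₀ (renewedSummand d)

    squareSummand-cong : ∀ d {t t′} → t ≗ t′ → squareSummand d t ≡ squareSummand d t′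
    squareSummand-cong d t≗t′ = ≡.cong (λ t → squareSummand d (corners t)) (values t≗t′)

    renewedSummand-cong : ∀ d {τ τ′} → τ ≗ τ′ → renewedSummand d τ ≡ renewedSummand d τ′
    renewedSummand-cong d τ≗τ′ = ≡.cong₂ (λ g s → renewedSummand d [ corners g , corners s ]′)
                                        (values (τ≗τ′ ∘ inj₁)) (values (τ≗τ′ ∘ inj₂))

    module _ (xX*xiX≈1 : xX * xiX ≈ 1#) (xX′*z≈1 : xX′ * z ≈ 1#) where

      private
        S : Carrier
        S = y 0F * y 2F * x 1F * x 3F + y 1F * y 3F * x 0F * x 2F

        z*S≈xX : z * S ≈ xX
        z*S≈xX = begin
          z * S                 ≈⟨ sym (*-identityʳ _) ⟩
          z * S * 1#            ≈⟨ *-congˡ (sym xX*xiX≈1) ⟩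
          z * S * (xX * xiX)    ≈⟨ solve 4 (λ z S xX xiX → z :* S :* (xX :* xiX) := xX :* (S :* xiX :* z)) refl z S xX xiX ⟩
          xX * (S * xiX * z)    ≈⟨ *-congˡ xX′*z≈1 ⟩
          xX * 1#               ≈⟨ *-identityʳ xX ⟩
          xX                    ∎

      -- Only for the patterns where no corner or every corner is covered do the two sides
      -- differ after computation.
      cornerCases : ∀ a b c e t₀ τ₀ → val (squareSum (corners (a , b , c , e)) t₀) ≈ val (renewedSum (corners (a , b , c , e)) τ₀)
      cornerCases false false false false t₀ τ₀ =
        solve 13 (λ y₀ y₁ y₂ y₃ x₀ x₁ x₂ x₃ p₀ p₁ p₂ p₃ xiX →
                    y₁ :* y₃ :* (xiX :* (x₀ :* p₀ :* (p₁ :* (x₂ :* p₂ :* p₃)))) :+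
                    y₀ :* y₂ :* (xiX :* (p₀ :* (x₁ :* p₁ :* (p₂ :* (x₃ :* p₃)))))
                 := con 1 :* ((y₀ :* y₂ :* x₁ :* x₃ :+ y₁ :* y₃ :* x₀ :* x₂) :* xiX :* con 1 :* (p₀ :* (p₁ :* (p₂ :* p₃)))))
              refl (y 0F) (y 1F) (y 2F) (y 3F) (x 0F) (x 1F) (x 2F) (x 3F) (P 0F) (P 1F) (P 2F) (P 3F) xiX
      cornerCases true true true true t₀ τ₀ = begin
        1# * (xX * 1# * Q)  ≈⟨ solve 2 (λ xX Q → con 1 :* (xX :* con 1 :* Q) := xX :* Q) refl xX Q ⟩
        xX * Q              ≈⟨ *-congʳ (sym z*S≈xX) ⟩
        z * S * Q           ≈⟨ solve 13 (λ y₀ y₁ y₂ y₃ x₀ x₁ x₂ x₃ p₀ p₁ p₂ p₃ z →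
                                 z :* (y₀ :* y₂ :* x₁ :* x₃ :+ y₁ :* y₃ :* x₀ :* x₂) :* (x₀ :* p₀ :* (x₁ :* p₁ :* (x₂ :* p₂ :* (x₃ :* p₃))))
                              := y₃ :* y₁ :* (z :* (x₀ :* (x₀ :* p₀) :* (x₁ :* p₁ :* (x₂ :* (x₂ :* p₂) :* (x₃ :* p₃))))) :+
                                 y₂ :* y₀ :* (z :* (x₀ :* p₀ :* (x₁ :* (x₁ :* p₁) :* (x₂ :* p₂ :* (x₃ :* (x₃ :* p₃)))))))
                              refl (y 0F) (y 1F) (y 2F) (y 3F) (x 0F) (x 1F) (x 2F) (x 3F) (P 0F) (P 1F) (P 2F) (P 3F) z ⟩
        _                   ∎
        where
        Q = x 0F * P 0F * (x 1F * P 1F * (x 2F * P 2F * (x 3F * P 3F)))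
      cornerCases false false false true  t₀ τ₀ = refl
      cornerCases false false true  false t₀ τ₀ = refl
      cornerCases false false true  true  t₀ τ₀ = refl
      cornerCases false true  false false t₀ τ₀ = refl
      cornerCases false true  false true  t₀ τ₀ = refl
      cornerCases false true  true  false t₀ τ₀ = refl
      cornerCases false true  true  true  t₀ τ₀ = refl
      cornerCases true  false false false t₀ τ₀ = refl
      cornerCases true  false false true  t₀ τ₀ = refl
      cornerCases true  false true  false t₀ τ₀ = refl
      cornerCases true  false true  true  t₀ τ₀ = refl
      cornerCases true  true  false false t₀ τ₀ = refl
      cornerCases true  true  false true  t₀ τ₀ = refl
      cornerCases true  true  true  false t₀ τ₀ = refl

      squareSum≈renewedSum : ∀ covered t₀ τ₀ → val (squareSum covered t₀) ≈ val (renewedSum covered τ₀)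
      squareSum≈renewedSum covered = cornerCases (covered 0F) (covered 1F) (covered 2F) (covered 3F)

countFin≡sum : ∀ n p → countFin n p ≡ sum (map (𝟙 ∘ p) (finList n))
countFin≡sum zero    p = ≡.refl
countFin≡sum (suc n) p = ≡.cong₂ ℕ._+_ (if≡𝟙 (p zero)) (begin
  countFin n (p ∘ suc)                          ≡⟨ countFin≡sum n (p ∘ suc) ⟩
  sum (map (𝟙 ∘ p ∘ suc) (finList n))           ≡⟨ ≡.cong sum (map-tabulate (λ i → i) (𝟙 ∘ p ∘ suc)) ⟩
  sum (tabulate (𝟙 ∘ p ∘ suc))                  ≡⟨ ≡.cong sum (map-tabulate suc (𝟙 ∘ p)) ⟨
  sum (map (𝟙 ∘ p) (tabulate suc))              ∎)
  where
  open ≡.≡-Reasoning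
  if≡𝟙 : ∀ b → (if b then 1 else 0) ≡ 𝟙 b
  if≡𝟙 true  = ≡.refl
  if≡𝟙 false = ≡.refl

sameEnds-∨ : ∀ {A : Set} (_≟A_ : DecidableEquality A) {a b c d : A} → SameEnds a b c d → ∀ u →
             (does (a ≟A u) ∨ does (b ≟A u)) ≡ (does (c ≟A u) ∨ does (d ≟A u))
sameEnds-∨ _≟A_ (inj₁ (≡.refl , ≡.refl)) u = ≡.refl
sameEnds-∨ _≟A_ {a} {b} (inj₂ (≡.refl , ≡.refl)) u = Boolₚ.∨-comm (does (a ≟A u)) (does (b ≟A u))

sameEnds-+ : ∀ {A : Set} (_≟A_ : DecidableEquality A) {a b c d : A} → SameEnds a b c d → ∀ u →
             𝟙 (does (a ≟A u)) ℕ.+ 𝟙 (does (b ≟A u)) ≡ 𝟙 (does (c ≟A u)) ℕ.+ 𝟙 (does (d ≟A u))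
sameEnds-+ _≟A_ (inj₁ (≡.refl , ≡.refl)) u = ≡.refl
sameEnds-+ _≟A_ {a} {b} (inj₂ (≡.refl , ≡.refl)) u = ℕₚ.+-comm (𝟙 (does (a ≟A u))) (𝟙 (does (b ≟A u)))

𝟙-∧-+ : ∀ a b m → 𝟙 (a ∧ m) ℕ.+ 𝟙 (b ∧ m) ≡ (𝟙 a ℕ.+ 𝟙 b) ℕ.* 𝟙 m
𝟙-∧-+ true  true  true  = ≡.refl
𝟙-∧-+ true  false true  = ≡.refl
𝟙-∧-+ false true  true  = ≡.refl
𝟙-∧-+ false false true  = ≡.refl
𝟙-∧-+ true  true  false = ≡.refl
𝟙-∧-+ true  false false = ≡.refl
𝟙-∧-+ false true  false = ≡.refl
𝟙-∧-+ false false false = ≡.refl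

sum-map-+ : ∀ {A : Set} (f g : A → ℕ) xs → sum (map f xs) ℕ.+ sum (map g xs) ≡ sum (map (λ a → f a ℕ.+ g a) xs)
sum-map-+ f g []       = ≡.refl
sum-map-+ f g (x ∷ xs) = ≡.trans (ℕ-interchange (f x) (sum (map f xs)) (g x) (sum (map g xs)))
                                 (≡.cong (f x ℕ.+ g x ℕ.+_) (sum-map-+ f g xs))
  where open import Algebra.Properties.CommutativeSemigroup ℕₚ.+-commutativeSemigroup renaming (interchange to ℕ-interchange)

unique-↭ : ∀ {A : Set} {xs ys : List A} (P : A → Set) → Unique xs → Unique ys →
           (∀ {c} → c ∈ xs ⇔ P c) → (∀ {c} → c ∈ ys ⇔ P c) → xs ↭ ys
unique-↭ P xs! ys! xs⇔P ys⇔P = ∼bag⇒↭ (unique∧set⇒bag xs! ys! (⇔.trans xs⇔P (⇔.sym ys⇔P)))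

module Decomposition (G : GraphWithOpenFaces) (S : SquareFace G) (G′ : GraphWithOpenFaces) (renewal : Renewal G S G′) where
  open GraphWithOpenFaces using (nV; faceOf)
  open SquareFace S
  open Renewal renewal

  Edge : Set
  Edge = EClass (nE G)

  Vertex : Set
  Vertex = Fin (nV G) ⊎ Fin 4

  Face : Set
  Face = Fin (nF G) ⊎ ⊤

  old-injective : ∀ {a b} → old {nE G} a ≡ old b → a ≡ b
  old-injective ≡.refl = ≡.refl

  private
    gE-injective : ∀ {j k} → gE {nE G} j ≡ gE k → j ≡ k
    gE-injective ≡.refl = ≡.refl

    sE-injective : ∀ {j k} → sE {nE G} j ≡ sE k → j ≡ k
    sE-injective ≡.refl = ≡.refl

  _≟ᴱ_ : DecidableEquality Edge
  old a ≟ᴱ old b = map′ (≡.cong old) old-injective (a Finₚ.≟ b)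
  gE j  ≟ᴱ gE k  = map′ (≡.cong gE) gE-injective (j Finₚ.≟ k)
  sE j  ≟ᴱ sE k  = map′ (≡.cong sE) sE-injective (j Finₚ.≟ k)
  old _ ≟ᴱ gE _  = no λ ()
  old _ ≟ᴱ sE _  = no λ ()
  gE _  ≟ᴱ old _ = no λ ()
  gE _  ≟ᴱ sE _  = no λ ()
  sE _  ≟ᴱ old _ = no λ ()
  sE _  ≟ᴱ gE _  = no λ ()

  _≟ⱽ_ : DecidableEquality Vertex
  _≟ⱽ_ = ⊎ₚ.≡-dec Finₚ._≟_ Finₚ._≟_

  _≟ᶠ_ : DecidableEquality Face
  _≟ᶠ_ = ⊎ₚ.≡-dec Finₚ._≟_ ⊤ₚ._≟_

  IsSquareEdge : Fin (nE G) → Set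
  IsSquareEdge a = ∃[ k ] a ≡ e k

  isSquareEdge? : Decidable IsSquareEdge
  isSquareEdge? a = Finₚ.any? (λ k → a Finₚ.≟ e k)

  squareEdge : Fin 4 → Edge
  squareEdge k = old (e k)

  renewedEdge : Fin 4 ⊎ Fin 4 → Edge
  renewedEdge (inj₁ k) = gE k
  renewedEdge (inj₂ k) = sE k

  edgesOfG edgesOfG′ squareEdges renewedEdges outerEdges : List Edge
  edgesOfG     = map old (finList (nE G))
  edgesOfG′    = map clsE (finList (nE G′))
  squareEdges  = map squareEdge (finList 4)
  renewedEdges = map renewedEdge renewedIndices
  outerEdges   = map old (filter (¬? ∘ isSquareEdge?) (finList (nE G)))

  squareEdge-injective : Injective _≡_ _≡_ squareEdge
  squareEdge-injective = e-inj _ _ ∘ old-injective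

  renewedEdge-injective : Injective _≡_ _≡_ renewedEdge
  renewedEdge-injective {inj₁ j} {inj₁ k} eq = ≡.cong inj₁ (gE-injective eq)
  renewedEdge-injective {inj₂ j} {inj₂ k} eq = ≡.cong inj₂ (sE-injective eq)
  renewedEdge-injective {inj₁ j} {inj₂ k} ()
  renewedEdge-injective {inj₂ j} {inj₁ k} ()

  ∈-outerEdges⁻ : ∀ {c} → c ∈ outerEdges → ∃[ a ] c ≡ old a × ¬ IsSquareEdge a
  ∈-outerEdges⁻ c∈ with ∈-map⁻ old c∈
  ... | a , a∈ , ≡.refl = a , ≡.refl , proj₂ (∈-filter⁻ (¬? ∘ isSquareEdge?) {xs = finList (nE G)} a∈)

  ∈-outerEdges⁺ : ∀ {a} → ¬ IsSquareEdge a → old a ∈ outerEdges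
  ∈-outerEdges⁺ {a} a∉ = ∈-map⁺ old (∈-filter⁺ (¬? ∘ isSquareEdge?) (∈-allFin a) a∉)

  outer∉squareEdges : ∀ {c} → c ∈ outerEdges → c ∉ squareEdges
  outer∉squareEdges c∈ c∈′ with ∈-outerEdges⁻ c∈ | ∈-map⁻ squareEdge c∈′
  ... | a , ≡.refl , a∉ | k , _ , eq = a∉ (k , old-injective eq)

  outer∉renewedEdges : ∀ {c} → c ∈ outerEdges → c ∉ renewedEdges
  outer∉renewedEdges c∈ c∈′ with ∈-outerEdges⁻ c∈ | ∈-map⁻ renewedEdge c∈′
  ... | a , ≡.refl , _ | inj₁ k , _ , ()
  ... | a , ≡.refl , _ | inj₂ k , _ , ()

  private
    unique-finList : ∀ {A : Set} n {f : Fin n → A} → Injective _≡_ _≡_ f → Unique (map f (finList n))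
    unique-finList n f-inj = Uniqueₚ.map⁺ f-inj (Uniqueₚ.allFin⁺ n)

    renewedIndices-unique : Unique renewedIndices
    renewedIndices-unique = Uniqueₚ.++⁺ (unique-finList 4 ⊎ₚ.inj₁-injective) (unique-finList 4 ⊎ₚ.inj₂-injective) disjoint
      where
      disjoint : ∀ {i} → ¬ (i ∈ map inj₁ (finList 4) × i ∈ map inj₂ (finList 4))
      disjoint (i∈ , j∈) with ∈-map⁻ inj₁ i∈ | ∈-map⁻ inj₂ j∈
      ... | _ , _ , ≡.refl | _ , _ , ()

    outerEdges-unique : Unique outerEdges
    outerEdges-unique = Uniqueₚ.map⁺ old-injective (Uniqueₚ.filter⁺ (¬? ∘ isSquareEdge?) (Uniqueₚ.allFin⁺ (nE G)))

    OldEdge : Edge → Set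
    OldEdge c = ∃[ a ] c ≡ old a

    ∈-edgesOfG⇔ : ∀ {c} → c ∈ edgesOfG ⇔ OldEdge c
    ∈-edgesOfG⇔ = mk⇔ (λ c∈ → case ∈-map⁻ old c∈ of λ (a , _ , eq) → a , eq) λ { (a , ≡.refl) → ∈-map⁺ old (∈-allFin a) }

  edgesOfG-↭ : edgesOfG ↭ squareEdges ++ outerEdges
  edgesOfG-↭ = unique-↭ OldEdge (unique-finList (nE G) old-injective)
    (Uniqueₚ.++⁺ (unique-finList 4 squareEdge-injective) outerEdges-unique λ (c∈ , c∈′) → outer∉squareEdges c∈′ c∈)
    ∈-edgesOfG⇔ (mk⇔ to from)
    where
    to : ∀ {c} → c ∈ squareEdges ++ outerEdges → OldEdge c
    to c∈ with ∈-++⁻ squareEdges c∈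
    ... | inj₁ c∈′ with ∈-map⁻ squareEdge c∈′
    ...   | k , _ , eq = e k , eq
    to c∈ | inj₂ c∈′ with ∈-outerEdges⁻ c∈′
    ...   | a , eq , _ = a , eq
    from : ∀ {c} → OldEdge c → c ∈ squareEdges ++ outerEdges
    from (a , ≡.refl) with isSquareEdge? a
    ... | yes (k , ≡.refl) = ∈-++⁺ˡ (∈-map⁺ squareEdge (∈-allFin k))
    ... | no a∉            = ∈-++⁺ʳ squareEdges (∈-outerEdges⁺ a∉)

  edgesOfG′-↭ : edgesOfG′ ↭ renewedEdges ++ outerEdges
  edgesOfG′-↭ = unique-↭ (NewEdge G S) (unique-finList (nE G′) (clsE-inj _ _))
    (Uniqueₚ.++⁺ (Uniqueₚ.map⁺ renewedEdge-injective renewedIndices-unique) outerEdges-unique λ (c∈ , c∈′) → outer∉renewedEdges c∈′ c∈)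
    (mk⇔ (λ c∈ → case ∈-map⁻ clsE c∈ of λ { (a , _ , ≡.refl) → clsE-img a })
         (λ new → case clsE-surj _ new of λ { (a , ≡.refl) → ∈-map⁺ clsE (∈-allFin a) }))
    (mk⇔ to from)
    where
    to : ∀ {c} → c ∈ renewedEdges ++ outerEdges → NewEdge G S c
    to c∈ with ∈-++⁻ renewedEdges c∈
    ... | inj₁ c∈′ with ∈-map⁻ renewedEdge c∈′
    ...   | inj₁ k , _ , ≡.refl = tt
    ...   | inj₂ k , _ , ≡.refl = tt
    to c∈ | inj₂ c∈′ with ∈-outerEdges⁻ c∈′
    ...   | a , ≡.refl , a∉ = a∉
    from : ∀ {c} → NewEdge G S c → c ∈ renewedEdges ++ outerEdges
    from {old a} a∉ = ∈-++⁺ʳ renewedEdges (∈-outerEdges⁺ a∉)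
    from {gE k}  _  = ∈-++⁺ˡ (∈-map⁺ renewedEdge {xs = renewedIndices} (∈-++⁺ˡ (∈-map⁺ inj₁ (∈-allFin k))))
    from {sE k}  _  = ∈-++⁺ˡ (∈-map⁺ renewedEdge {xs = renewedIndices} (∈-++⁺ʳ (map inj₁ (finList 4)) (∈-map⁺ inj₂ (∈-allFin k))))

  IsSquareFace : Fin (nF G) → Set
  IsSquareFace f = f ≡ X ⊎ ∃[ k ] f ≡ F k

  isSquareFace? : Decidable IsSquareFace
  isSquareFace? f = (f Finₚ.≟ X) ⊎-dec Finₚ.any? (λ k → f Finₚ.≟ F k)

  facesOfG facesOfG′ borderFaces otherFaces : List Face
  facesOfG    = map inj₁ (finList (nF G))
  facesOfG′   = map clsF (finList (nF G′))
  borderFaces = map (inj₁ ∘ F) (finList 4)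
  otherFaces  = map inj₁ (filter (¬? ∘ isSquareFace?) (finList (nF G)))

  -- The face on the outer side of s_k is F_k, which is a face of G′ and so differs from X.
  F≢X : ∀ k → F k ≢ X
  F≢X k with clsE-surj (sE k) tt
  ... | a , clsE-a with faces a
  ... | sides rewrite clsE-a with sides
  ...   | inj₁ (clsF-a , _) = ≡.subst (NewFace G S) clsF-a (clsF-img (faceOf G′ (a , false)))
  ...   | inj₂ (_ , clsF-a) = ≡.subst (NewFace G S) clsF-a (clsF-img (faceOf G′ (a , true)))

  ∈-otherFaces⁻ : ∀ {c} → c ∈ otherFaces → ∃[ f ] c ≡ inj₁ f × ¬ IsSquareFace f
  ∈-otherFaces⁻ c∈ with ∈-map⁻ inj₁ c∈
  ... | f , f∈ , ≡.refl = f , ≡.refl , proj₂ (∈-filter⁻ (¬? ∘ isSquareFace?) {xs = finList (nF G)} f∈)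

  other∉borderFaces : ∀ {c} → c ∈ otherFaces → c ∉ borderFaces
  other∉borderFaces c∈ c∈′ with ∈-otherFaces⁻ c∈ | ∈-map⁻ (inj₁ ∘ F) c∈′
  ... | f , ≡.refl , f∉ | k , _ , ≡.refl = f∉ (inj₂ (k , ≡.refl))

  private
    borderFaces-unique : Unique (borderFaces ++ otherFaces)
    borderFaces-unique = Uniqueₚ.++⁺ (Uniqueₚ.map⁺ (F-inj _ _ ∘ ⊎ₚ.inj₁-injective) (Uniqueₚ.allFin⁺ 4))
      (Uniqueₚ.map⁺ ⊎ₚ.inj₁-injective (Uniqueₚ.filter⁺ (¬? ∘ isSquareFace?) (Uniqueₚ.allFin⁺ (nF G))))
      λ (c∈ , c∈′) → other∉borderFaces c∈′ c∈

    ∈-border++other⁻ : ∀ {c} → c ∈ borderFaces ++ otherFaces → ∃[ f ] c ≡ inj₁ f × f ≢ X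
    ∈-border++other⁻ c∈ with ∈-++⁻ borderFaces c∈
    ... | inj₁ c∈′ with ∈-map⁻ (inj₁ ∘ F) c∈′
    ...   | k , _ , ≡.refl = F k , ≡.refl , F≢X k
    ∈-border++other⁻ c∈ | inj₂ c∈′ with ∈-otherFaces⁻ c∈′
    ...   | f , ≡.refl , f∉ = f , ≡.refl , f∉ ∘ inj₁

    ∈-border++other⁺ : ∀ {f} → f ≢ X → inj₁ f ∈ borderFaces ++ otherFaces
    ∈-border++other⁺ {f} f≢X with isSquareFace? f
    ... | yes (inj₁ f≡X)          = ⊥-elim (f≢X f≡X)
    ... | yes (inj₂ (k , ≡.refl)) = ∈-++⁺ˡ (∈-map⁺ (inj₁ ∘ F) (∈-allFin k))
    ... | no f∉                   = ∈-++⁺ʳ borderFaces (∈-map⁺ inj₁ (∈-filter⁺ (¬? ∘ isSquareFace?) (∈-allFin f) f∉))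

  facesOfG-↭ : facesOfG ↭ inj₁ X ∷ borderFaces ++ otherFaces
  facesOfG-↭ = unique-↭ (λ c → ∃[ f ] c ≡ inj₁ f) (Uniqueₚ.map⁺ ⊎ₚ.inj₁-injective (Uniqueₚ.allFin⁺ (nF G)))
    (¬Any⇒All¬ _ (λ X∈ → case ∈-border++other⁻ X∈ of λ { (_ , ≡.refl , X≢X) → X≢X ≡.refl }) ∷ borderFaces-unique)
    (mk⇔ (λ c∈ → case ∈-map⁻ inj₁ c∈ of λ { (f , _ , eq) → f , eq }) λ { (f , ≡.refl) → ∈-map⁺ inj₁ (∈-allFin f) })
    (mk⇔ to from)
    where
    to : ∀ {c} → c ∈ inj₁ X ∷ borderFaces ++ otherFaces → ∃[ f ] c ≡ inj₁ f
    to (here eq)  = X , eq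
    to (there c∈) = case ∈-border++other⁻ c∈ of λ { (f , eq , _) → f , eq }
    from : ∀ {c} → ∃[ f ] c ≡ inj₁ f → c ∈ inj₁ X ∷ borderFaces ++ otherFaces
    from (f , ≡.refl) with f Finₚ.≟ X
    ... | yes ≡.refl = here ≡.refl
    ... | no f≢X     = there (∈-border++other⁺ f≢X)

  facesOfG′-↭ : facesOfG′ ↭ inj₂ tt ∷ borderFaces ++ otherFaces
  facesOfG′-↭ = unique-↭ (NewFace G S) (Uniqueₚ.map⁺ (clsF-inj _ _) (Uniqueₚ.allFin⁺ (nF G′)))
    (¬Any⇒All¬ _ (λ X′∈ → case ∈-border++other⁻ X′∈ of λ { (_ , () , _) }) ∷ borderFaces-unique)
    (mk⇔ (λ c∈ → case ∈-map⁻ clsF c∈ of λ { (a , _ , ≡.refl) → clsF-img a })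
         (λ new → case clsF-surj _ new of λ { (a , ≡.refl) → ∈-map⁺ clsF (∈-allFin a) }))
    (mk⇔ to from)
    where
    to : ∀ {c} → c ∈ inj₂ tt ∷ borderFaces ++ otherFaces → NewFace G S c
    to (here ≡.refl) = tt
    to (there c∈)    = case ∈-border++other⁻ c∈ of λ { (f , ≡.refl , f≢X) → f≢X }
    from : ∀ {c} → NewFace G S c → c ∈ inj₂ tt ∷ borderFaces ++ otherFaces
    from {inj₁ f}  f≢X = there (∈-border++other⁺ f≢X)
    from {inj₂ tt} _   = here ≡.refl

  tally : List Edge → Assignment Edge → (Edge → Bool → ℕ) → ℕ
  tally cs ρ w = sum (map (λ c → w c (ρ c)) cs)

  tally-cong : ∀ cs {ρ σ w w′} → (∀ {c} → c ∈ cs → w c (ρ c) ≡ w′ c (σ c)) → tally cs ρ w ≡ tally cs σ w′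
  tally-cong cs eq = ≡.cong sum (map-cong-local (All.tabulate eq))

  tally-split : ∀ {es cs} ρ σ w → es ↭ cs ++ outerEdges → (∀ {c} → c ∈ outerEdges → c ∉ cs) → AgreeOff cs ρ σ →
                tally es ρ w ≡ tally cs ρ w ℕ.+ tally outerEdges σ w
  tally-split {es} {cs} ρ σ w es↭ disjoint agree = begin
    tally es ρ w                                    ≡⟨ Sumₚ.sum-↭ (↭ₚ.map⁺ _ es↭) ⟩
    sum (map ρw (cs ++ outerEdges))                 ≡⟨ ≡.cong sum (map-++ ρw cs outerEdges) ⟩
    sum (map ρw cs ++ map ρw outerEdges)            ≡⟨ Sumₚ.sum-++ (map ρw cs) (map ρw outerEdges) ⟩
    tally cs ρ w ℕ.+ tally outerEdges ρ w
      ≡⟨ ≡.cong (tally cs ρ w ℕ.+_) (tally-cong outerEdges {w = w} {w′ = w} λ {c} c∈ → ≡.cong (w c) (agree c (disjoint c∈))) ⟩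
    tally cs ρ w ℕ.+ tally outerEdges σ w           ∎
    where
    open ≡.≡-Reasoning
    ρw = λ c → w c (ρ c)

  incidentTo : Edge → Vertex → Bool
  incidentTo c u = does (endL G S c ≟ⱽ u) ∨ does (endR G S c ≟ⱽ u)

  sidesOn : Edge → Face → ℕ
  sidesOn c f = 𝟙 (does (faceL G S c ≟ᶠ f)) ℕ.+ 𝟙 (does (faceR G S c ≟ᶠ f))

  -- The incidence test comes first, so that summands for concrete edges near the square compute.
  degree : List Edge → Assignment Edge → Vertex → ℕ
  degree cs ρ u = tally cs ρ (λ c b → 𝟙 (incidentTo c u ∧ b))

  -- onBoundary (λ b → b) counts α_F and onBoundary not counts β_F.
  onBoundary : (Bool → Bool) → List Edge → Assignment Edge → Face → ℕ
  onBoundary q cs ρ f = tally cs ρ (λ c b → sidesOn c f ℕ.* 𝟙 (q b))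

  module Classified (H : GraphWithOpenFaces) (cls : Fin (nE H) → Edge) where
    open GraphWithOpenFaces H using () renaming (src to srcᴴ; tgt to tgtᴴ; faceOf to faceOfᴴ)
    open ≡.≡-Reasoning

    edgesOf : List Edge
    edgesOf = map cls (finList (nE H))

    private
      sum-map-cls : ∀ (h : Edge → ℕ) → sum (map (h ∘ cls) (finList (nE H))) ≡ sum (map h edgesOf)
      sum-map-cls h = ≡.cong sum (map-∘ (finList (nE H)))

    countFin≡degree : (clsV : Fin (nV H) → Vertex) → Injective _≡_ _≡_ clsV →
      (∀ a → SameEnds (clsV (srcᴴ a)) (clsV (tgtᴴ a)) (endL G S (cls a)) (endR G S (cls a))) →
      ∀ ρ w → countFin (nE H) (λ a → ρ (cls a) ∧ incident H a w) ≡ degree edgesOf ρ (clsV w)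
    countFin≡degree clsV clsV-inj ends ρ w = begin
      countFin (nE H) (λ a → ρ (cls a) ∧ incident H a w)
        ≡⟨ countFin≡sum (nE H) _ ⟩
      sum (map (λ a → 𝟙 (ρ (cls a) ∧ incident H a w)) (finList (nE H)))
        ≡⟨ ≡.cong sum (map-cong-local {xs = finList (nE H)} (All.tabulate λ {a} _ → ≡.cong 𝟙 (incident-swap a))) ⟩
      sum (map (λ a → 𝟙 (incidentTo (cls a) (clsV w) ∧ ρ (cls a))) (finList (nE H)))
        ≡⟨ sum-map-cls (λ c → 𝟙 (incidentTo c (clsV w) ∧ ρ c)) ⟩
      degree edgesOf ρ (clsV w) ∎
      where
      incident-swap : ∀ a → (ρ (cls a) ∧ incident H a w) ≡ (incidentTo (cls a) (clsV w) ∧ ρ (cls a))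
      incident-swap a = ≡.trans (Boolₚ.∧-comm (ρ (cls a)) _) (≡.cong (_∧ ρ (cls a)) (begin
        incident H a w
          ≡⟨ ≡.cong₂ _∨_ (does-injective Finₚ._≟_ _≟ⱽ_ clsV clsV-inj (srcᴴ a) w)
                          (does-injective Finₚ._≟_ _≟ⱽ_ clsV clsV-inj (tgtᴴ a) w) ⟨
        does (clsV (srcᴴ a) ≟ⱽ clsV w) ∨ does (clsV (tgtᴴ a) ≟ⱽ clsV w)
          ≡⟨ sameEnds-∨ _≟ⱽ_ (ends a) (clsV w) ⟩
        incidentTo (cls a) (clsV w) ∎))

    countDart≡onBoundary : (clsF : Fin (nF H) → Face) → Injective _≡_ _≡_ clsF →
      (∀ a → SameEnds (clsF (faceOfᴴ (a , false))) (clsF (faceOfᴴ (a , true))) (faceL G S (cls a)) (faceR G S (cls a))) →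
      ∀ q ρ f → countDart (nE H) (λ d → does (faceOfᴴ d Finₚ.≟ f) ∧ q (ρ (cls (proj₁ d)))) ≡ onBoundary q edgesOf ρ (clsF f)
    countDart≡onBoundary clsF clsF-inj faces q ρ f = begin
      countFin (nE H) (λ a → side false a ∧ m a) ℕ.+ countFin (nE H) (λ a → side true a ∧ m a)
        ≡⟨ ≡.cong₂ ℕ._+_ (countFin≡sum (nE H) _) (countFin≡sum (nE H) _) ⟩
      sum (map (λ a → 𝟙 (side false a ∧ m a)) (finList (nE H))) ℕ.+ sum (map (λ a → 𝟙 (side true a ∧ m a)) (finList (nE H)))
        ≡⟨ sum-map-+ _ _ (finList (nE H)) ⟩
      sum (map (λ a → 𝟙 (side false a ∧ m a) ℕ.+ 𝟙 (side true a ∧ m a)) (finList (nE H)))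
        ≡⟨ ≡.cong sum (map-cong-local {xs = finList (nE H)} (All.tabulate λ {a} _ → sides a)) ⟩
      sum (map (λ a → sidesOn (cls a) (clsF f) ℕ.* 𝟙 (m a)) (finList (nE H)))
        ≡⟨ sum-map-cls (λ c → sidesOn c (clsF f) ℕ.* 𝟙 (q (ρ c))) ⟩
      onBoundary q edgesOf ρ (clsF f) ∎
      where
      side : Bool → Fin (nE H) → Bool
      side b a = does (faceOfᴴ (a , b) Finₚ.≟ f)
      m : Fin (nE H) → Bool
      m a = q (ρ (cls a))
      sides : ∀ a → 𝟙 (side false a ∧ m a) ℕ.+ 𝟙 (side true a ∧ m a) ≡ sidesOn (cls a) (clsF f) ℕ.* 𝟙 (m a)
      sides a = begin
        𝟙 (side false a ∧ m a) ℕ.+ 𝟙 (side true a ∧ m a)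
          ≡⟨ 𝟙-∧-+ (side false a) (side true a) (m a) ⟩
        (𝟙 (side false a) ℕ.+ 𝟙 (side true a)) ℕ.* 𝟙 (m a)
          ≡⟨ ≡.cong (ℕ._* 𝟙 (m a)) (≡.cong₂ ℕ._+_
               (≡.cong 𝟙 (does-injective Finₚ._≟_ _≟ᶠ_ clsF clsF-inj (faceOfᴴ (a , false)) f))
               (≡.cong 𝟙 (does-injective Finₚ._≟_ _≟ᶠ_ clsF clsF-inj (faceOfᴴ (a , true)) f))) ⟨
        (𝟙 (does (clsF (faceOfᴴ (a , false)) ≟ᶠ clsF f)) ℕ.+ 𝟙 (does (clsF (faceOfᴴ (a , true)) ≟ᶠ clsF f))) ℕ.* 𝟙 (m a)
          ≡⟨ ≡.cong (ℕ._* 𝟙 (m a)) (sameEnds-+ _≟ᶠ_ (faces a) (clsF f)) ⟩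
        sidesOn (cls a) (clsF f) ℕ.* 𝟙 (m a) ∎

  tally-zero : ∀ cs ρ w → (∀ {c} → c ∈ cs → w c (ρ c) ≡ 0) → tally cs ρ w ≡ 0
  tally-zero []       ρ w _     = ≡.refl
  tally-zero (c ∷ cs) ρ w zeros = ≡.cong₂ ℕ._+_ (zeros (here ≡.refl)) (tally-zero cs ρ w (zeros ∘ there))

  tally-renewedEdges : ∀ ρ w → tally renewedEdges ρ w ≡ ∑⁴ (λ k → w (gE k) (ρ (gE k))) ℕ.+ ∑⁴ (λ k → w (sE k) (ρ (sE k)))
  tally-renewedEdges ρ w = Sumₚ.sum-++ (map (λ k → w (gE k) (ρ (gE k))) (finList 4)) (map (λ k → w (sE k) (ρ (sE k))) (finList 4))

  IsCorner : Fin (nV G) → Set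
  IsCorner w = ∃[ j ] w ≡ v j

  isCorner? : Decidable IsCorner
  isCorner? w = Finₚ.any? (λ j → w Finₚ.≟ v j)

  private
    incidentTo-square : ∀ k w → incidentTo (squareEdge k) (inj₁ w) ≡ does (v k Finₚ.≟ w) ∨ does (v (next4 k) Finₚ.≟ w)
    incidentTo-square k w = sameEnds-∨ Finₚ._≟_ (e-ends k) w

    sidesOn-square : ∀ k f → sidesOn (squareEdge k) (inj₁ f) ≡ 𝟙 (does (X Finₚ.≟ f)) ℕ.+ 𝟙 (does (F k Finₚ.≟ f))
    sidesOn-square k f = sameEnds-+ Finₚ._≟_ (e-faces k) f

    v-does : ∀ i j → does (v i Finₚ.≟ v j) ≡ does (i Finₚ.≟ j)
    v-does = does-injective Finₚ._≟_ Finₚ._≟_ v (v-inj _ _)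

    F-does : ∀ i j → does (F i Finₚ.≟ F j) ≡ does (i Finₚ.≟ j)
    F-does = does-injective Finₚ._≟_ Finₚ._≟_ F (F-inj _ _)

    F-does-X : ∀ k → does (F k Finₚ.≟ X) ≡ false
    F-does-X k = dec-false (F k Finₚ.≟ X) (F≢X k)

    nonSquare-does : ∀ {f} → ¬ IsSquareFace f → (does (X Finₚ.≟ f) ≡ false) × (∀ k → does (F k Finₚ.≟ f) ≡ false)
    nonSquare-does ¬square = dec-false (X Finₚ.≟ _) (λ eq → ¬square (inj₁ (≡.sym eq))) ,
                             λ k → dec-false (F k Finₚ.≟ _) (λ eq → ¬square (inj₂ (k , ≡.sym eq)))

    nonCorner-does : ∀ {w} → ¬ IsCorner w → ∀ k → does (v k Finₚ.≟ w) ≡ false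
    nonCorner-does ¬corner k = dec-false (v k Finₚ.≟ _) λ eq → ¬corner (k , ≡.sym eq)

  squareDegree-nonCorner : ∀ ρ w → ¬ IsCorner w → degree squareEdges ρ (inj₁ w) ≡ 0
  squareDegree-nonCorner ρ w ¬corner = ∑⁴-cong λ k → ≡.cong (λ b → 𝟙 (b ∧ ρ (squareEdge k)))
    (≡.trans (incidentTo-square k w) (≡.cong₂ _∨_ (nonCorner-does ¬corner k) (nonCorner-does ¬corner (next4 k))))

  squareDegree-corner : ∀ ρ j → degree squareEdges ρ (inj₁ (v j)) ≡ 𝟙 (ρ (squareEdge j)) ℕ.+ 𝟙 (ρ (squareEdge (prev4 j)))
  squareDegree-corner ρ j = ≡.trans
    (∑⁴-cong λ k → ≡.cong (λ b → 𝟙 (b ∧ ρ (squareEdge k))) (≡.trans (incidentTo-square k (v j)) (≡.cong₂ _∨_ (v-does k j) (v-does (next4 k) j))))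
    (aroundCorner j)
    where
    aroundCorner : ∀ j → ∑⁴ (λ k → 𝟙 ((does (k Finₚ.≟ j) ∨ does (next4 k Finₚ.≟ j)) ∧ ρ (squareEdge k))) ≡
                         𝟙 (ρ (squareEdge j)) ℕ.+ 𝟙 (ρ (squareEdge (prev4 j)))
    aroundCorner 0F = ≡.cong (𝟙 (ρ (squareEdge 0F)) ℕ.+_) (ℕₚ.+-identityʳ _)
    aroundCorner 1F = swap+0 (𝟙 (ρ (squareEdge 0F))) _
    aroundCorner 2F = swap+0 (𝟙 (ρ (squareEdge 1F))) _
    aroundCorner 3F = swap+0 (𝟙 (ρ (squareEdge 2F))) _

  renewedDegree-nonCorner : ∀ ρ w → ¬ IsCorner w → degree renewedEdges ρ (inj₁ w) ≡ 0
  renewedDegree-nonCorner ρ w ¬corner = ≡.trans (tally-renewedEdges ρ (λ c b → 𝟙 (incidentTo c (inj₁ w) ∧ b)))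
    (≡.cong (ℕ._+ 0) (∑⁴-cong λ k → ≡.cong (λ b → 𝟙 ((b ∨ false) ∧ ρ (gE k))) (nonCorner-does ¬corner k)))

  renewedDegree-corner : ∀ ρ j → degree renewedEdges ρ (inj₁ (v j)) ≡ 𝟙 (ρ (gE j))
  renewedDegree-corner ρ j = ≡.trans (tally-renewedEdges ρ (λ c b → 𝟙 (incidentTo c (inj₁ (v j)) ∧ b)))
    (≡.trans (≡.cong (ℕ._+ 0) (∑⁴-cong λ k → ≡.cong (λ b → 𝟙 ((b ∨ false) ∧ ρ (gE k))) (v-does k j))) (spoke j))
    where
    spoke : ∀ j → ∑⁴ (λ k → 𝟙 ((does (k Finₚ.≟ j) ∨ false) ∧ ρ (gE k))) ℕ.+ 0 ≡ 𝟙 (ρ (gE j))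
    spoke 0F = +0+0 _
    spoke 1F = +0+0 _
    spoke 2F = +0+0 _
    spoke 3F = +0+0 _

  renewedDegree-inner : ∀ ρ j → degree renewedEdges ρ (inj₂ j) ≡ 𝟙 (ρ (gE j)) ℕ.+ (𝟙 (ρ (sE j)) ℕ.+ 𝟙 (ρ (sE (prev4 j))))
  renewedDegree-inner ρ j = ≡.trans (tally-renewedEdges ρ (λ c b → 𝟙 (incidentTo c (inj₂ j) ∧ b))) (inner j)
    where
    inner : ∀ j → ∑⁴ (λ k → 𝟙 (incidentTo (gE k) (inj₂ j) ∧ ρ (gE k))) ℕ.+ ∑⁴ (λ k → 𝟙 (incidentTo (sE k) (inj₂ j) ∧ ρ (sE k)))
                  ≡ 𝟙 (ρ (gE j)) ℕ.+ (𝟙 (ρ (sE j)) ℕ.+ 𝟙 (ρ (sE (prev4 j))))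
    inner 0F = ≡.cong₂ ℕ._+_ (ℕₚ.+-identityʳ (𝟙 (ρ (gE 0F)))) (≡.cong (𝟙 (ρ (sE 0F)) ℕ.+_) (ℕₚ.+-identityʳ (𝟙 (ρ (sE 3F)))))
    inner 1F = ≡.cong₂ ℕ._+_ (ℕₚ.+-identityʳ (𝟙 (ρ (gE 1F)))) (swap+0 (𝟙 (ρ (sE 0F))) (𝟙 (ρ (sE 1F))))
    inner 2F = ≡.cong₂ ℕ._+_ (ℕₚ.+-identityʳ (𝟙 (ρ (gE 2F)))) (swap+0 (𝟙 (ρ (sE 1F))) (𝟙 (ρ (sE 2F))))
    inner 3F = ≡.cong₂ ℕ._+_ (ℕₚ.+-identityʳ (𝟙 (ρ (gE 3F)))) (swap+0 (𝟙 (ρ (sE 2F))) (𝟙 (ρ (sE 3F))))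

  outerDegree-inner : ∀ σ j → degree outerEdges σ (inj₂ j) ≡ 0
  outerDegree-inner σ j = tally-zero outerEdges σ (λ c b → 𝟙 (incidentTo c (inj₂ j) ∧ b)) λ c∈ →
    case ∈-outerEdges⁻ c∈ of λ { (a , ≡.refl , _) → ≡.refl }

  squareBoundary-X : ∀ q ρ → onBoundary q squareEdges ρ (inj₁ X) ≡ count (q ∘ ρ ∘ squareEdge)
  squareBoundary-X q ρ = ∑⁴-cong λ k → ≡.trans
    (≡.cong (ℕ._* 𝟙 (q (ρ (squareEdge k)))) (≡.trans (sidesOn-square k X)
      (≡.cong₂ ℕ._+_ (≡.cong 𝟙 (dec-true (X Finₚ.≟ X) ≡.refl)) (≡.cong 𝟙 (F-does-X k)))))
    (ℕₚ.*-identityˡ _)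

  squareBoundary-F : ∀ q ρ j → onBoundary q squareEdges ρ (inj₁ (F j)) ≡ 𝟙 (q (ρ (squareEdge j)))
  squareBoundary-F q ρ j = ≡.trans
    (∑⁴-cong λ k → ≡.cong (ℕ._* 𝟙 (q (ρ (squareEdge k)))) (≡.trans (sidesOn-square k (F j))
      (≡.cong₂ ℕ._+_ (≡.cong 𝟙 (dec-false (X Finₚ.≟ F j) (F≢X j ∘ ≡.sym))) (≡.cong 𝟙 (F-does k j)))))
    (∑⁴-select j (λ k → 𝟙 (q (ρ (squareEdge k)))))

  squareBoundary-other : ∀ q ρ f → ¬ IsSquareFace f → onBoundary q squareEdges ρ (inj₁ f) ≡ 0
  squareBoundary-other q ρ f ¬square = ∑⁴-cong λ k → ≡.cong (ℕ._* 𝟙 (q (ρ (squareEdge k))))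
    (≡.trans (sidesOn-square k f) (≡.cong₂ ℕ._+_ (≡.cong 𝟙 (proj₁ (nonSquare-does ¬square))) (≡.cong 𝟙 (proj₂ (nonSquare-does ¬square) k))))

  outerBoundary-X : ∀ q σ → onBoundary q outerEdges σ (inj₁ X) ≡ 0
  outerBoundary-X q σ = tally-zero outerEdges σ (λ c b → sidesOn c (inj₁ X) ℕ.* 𝟙 (q b)) λ c∈ →
    case ∈-outerEdges⁻ c∈ of λ { (a , ≡.refl , ¬square) →
      ≡.cong (ℕ._* 𝟙 (q (σ (old a)))) (≡.cong₂ ℕ._+_ (≡.cong 𝟙 (offX ¬square false)) (≡.cong 𝟙 (offX ¬square true))) }
    where
    offX : ∀ {a} → ¬ IsSquareEdge a → ∀ b → does (faceOf G (a , b) Finₚ.≟ X) ≡ false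
    offX ¬square b = dec-false (_ Finₚ.≟ X) (¬square ∘ X-boundary _)

  renewedBoundary-X′ : ∀ q ρ → onBoundary q renewedEdges ρ (inj₂ tt) ≡ count (q ∘ ρ ∘ sE)
  renewedBoundary-X′ q ρ = ≡.trans (tally-renewedEdges ρ (λ c b → sidesOn c (inj₂ tt) ℕ.* 𝟙 (q b)))
    (∑⁴-cong λ k → ℕₚ.*-identityˡ (𝟙 (q (ρ (sE k)))))

  outerBoundary-X′ : ∀ q σ → onBoundary q outerEdges σ (inj₂ tt) ≡ 0
  outerBoundary-X′ q σ = tally-zero outerEdges σ (λ c b → sidesOn c (inj₂ tt) ℕ.* 𝟙 (q b)) λ c∈ →
    case ∈-outerEdges⁻ c∈ of λ { (a , ≡.refl , _) → ≡.refl }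

  renewedBoundary-F : ∀ q ρ j → onBoundary q renewedEdges ρ (inj₁ (F j)) ≡
                      𝟙 (q (ρ (gE j))) ℕ.+ (𝟙 (q (ρ (sE j))) ℕ.+ 𝟙 (q (ρ (gE (next4 j)))))
  renewedBoundary-F q ρ j = begin
    onBoundary q renewedEdges ρ (inj₁ (F j))
      ≡⟨ tally-renewedEdges ρ (λ c b → sidesOn c (inj₁ (F j)) ℕ.* 𝟙 (q b)) ⟩
    ∑⁴ (λ k → sidesOn (gE k) (inj₁ (F j)) ℕ.* 𝟙 (q (ρ (gE k)))) ℕ.+ ∑⁴ (λ k → sidesOn (sE k) (inj₁ (F j)) ℕ.* 𝟙 (q (ρ (sE k))))
      ≡⟨ ≡.cong₂ ℕ._+_ (∑⁴-cong λ k → ≡.cong (ℕ._* 𝟙 (q (ρ (gE k)))) (≡.cong₂ ℕ._+_ (≡.cong 𝟙 (F-does (prev4 k) j)) (≡.cong 𝟙 (F-does k j))))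
                       (∑⁴-cong λ k → ≡.cong (λ n → (n ℕ.+ 0) ℕ.* 𝟙 (q (ρ (sE k)))) (≡.cong 𝟙 (F-does k j))) ⟩
    ∑⁴ (λ k → (𝟙 (does (prev4 k Finₚ.≟ j)) ℕ.+ 𝟙 (does (k Finₚ.≟ j))) ℕ.* 𝟙 (q (ρ (gE k)))) ℕ.+
    ∑⁴ (λ k → (𝟙 (does (k Finₚ.≟ j)) ℕ.+ 0) ℕ.* 𝟙 (q (ρ (sE k))))
      ≡⟨ border j ⟩
    𝟙 (q (ρ (gE j))) ℕ.+ (𝟙 (q (ρ (sE j))) ℕ.+ 𝟙 (q (ρ (gE (next4 j))))) ∎
    where
    open ≡.≡-Reasoning
    shape : ∀ a b c → ((a ℕ.+ 0) ℕ.+ ((b ℕ.+ 0) ℕ.+ 0)) ℕ.+ ((c ℕ.+ 0) ℕ.+ 0) ≡ a ℕ.+ (c ℕ.+ b)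
    shape = ℕ-Solver.solve-∀
    shape′ : ∀ a b c → ((b ℕ.+ 0) ℕ.+ ((a ℕ.+ 0) ℕ.+ 0)) ℕ.+ ((c ℕ.+ 0) ℕ.+ 0) ≡ a ℕ.+ (c ℕ.+ b)
    shape′ = ℕ-Solver.solve-∀
    g s : Fin 4 → ℕ
    g k = 𝟙 (q (ρ (gE k)))
    s k = 𝟙 (q (ρ (sE k)))
    border : ∀ j → ∑⁴ (λ k → (𝟙 (does (prev4 k Finₚ.≟ j)) ℕ.+ 𝟙 (does (k Finₚ.≟ j))) ℕ.* g k) ℕ.+
                   ∑⁴ (λ k → (𝟙 (does (k Finₚ.≟ j)) ℕ.+ 0) ℕ.* s k) ≡ g j ℕ.+ (s j ℕ.+ g (next4 j))
    border 0F = shape (g 0F) (g 1F) (s 0F)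
    border 1F = shape (g 1F) (g 2F) (s 1F)
    border 2F = shape (g 2F) (g 3F) (s 2F)
    border 3F = shape′ (g 3F) (g 0F) (s 3F)

  renewedBoundary-other : ∀ q ρ f → ¬ IsSquareFace f → onBoundary q renewedEdges ρ (inj₁ f) ≡ 0
  renewedBoundary-other q ρ f ¬square = ≡.trans (tally-renewedEdges ρ (λ c b → sidesOn c (inj₁ f) ℕ.* 𝟙 (q b)))
    (≡.cong₂ ℕ._+_
      (∑⁴-cong λ k → ≡.cong (ℕ._* 𝟙 (q (ρ (gE k)))) (≡.cong₂ ℕ._+_ (≡.cong 𝟙 (off (prev4 k))) (≡.cong 𝟙 (off k))))
      (∑⁴-cong λ k → ≡.cong (λ n → (n ℕ.+ 0) ℕ.* 𝟙 (q (ρ (sE k)))) (≡.cong 𝟙 (off k))))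
    where
    off = proj₂ (nonSquare-does ¬square)

  outerDegree : Assignment Edge → Fin (nV G) → ℕ
  outerDegree σ w = degree outerEdges σ (inj₁ w)

  covered : Assignment Edge → Fin 4 → Bool
  covered σ j = outerDegree σ (v j) ℕ.≡ᵇ 1

  outerVertexOK : Assignment Edge → Fin (nV G) → Bool
  outerVertexOK σ w = does (isCorner? w) ∨ (outerDegree σ w ℕ.≡ᵇ 1)

  cornerBound : Assignment Edge → Fin 4 → Bool
  cornerBound σ j = outerDegree σ (v j) ℕ.≤ᵇ 1

  outerOK : Assignment Edge → Bool
  outerOK σ = allFin (nV G) (outerVertexOK σ) ∧ allFin 4 (cornerBound σ)

  T-outerOK : ∀ σ → T (outerOK σ) ⇔ ((∀ w → T (outerVertexOK σ w)) × (∀ j → T (cornerBound σ j)))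
  T-outerOK σ = ⇔.trans Boolₚ.T-∧ (T-allFin (nV G) (outerVertexOK σ) ×-⇔ T-allFin 4 (cornerBound σ))

  oldVertices⇔ : ∀ σ (near : Fin (nV G) → ℕ) (nearOK : Fin 4 → Bool) →
    (∀ w → ¬ IsCorner w → near w ≡ 0) →
    (∀ j → (near (v j) ℕ.+ outerDegree σ (v j) ℕ.≡ᵇ 1) ≡ cornerBound σ j ∧ nearOK j) →
    (∀ w → T (near w ℕ.+ outerDegree σ w ℕ.≡ᵇ 1)) ⇔ (T (outerOK σ) × (∀ j → T (nearOK j)))
  oldVertices⇔ σ near nearOK far corner = mk⇔ to from
    where
    atNonCorner : ∀ w → ¬ IsCorner w → (near w ℕ.+ outerDegree σ w ℕ.≡ᵇ 1) ≡ (outerDegree σ w ℕ.≡ᵇ 1)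
    atNonCorner w ¬corner = ≡.cong (λ n → n ℕ.+ outerDegree σ w ℕ.≡ᵇ 1) (far w ¬corner)

    to : (∀ w → T (near w ℕ.+ outerDegree σ w ℕ.≡ᵇ 1)) → T (outerOK σ) × (∀ j → T (nearOK j))
    to h = Equivalence.from (T-outerOK σ) (outer , proj₁ ∘ atCorner) , proj₂ ∘ atCorner
      where
      atCorner : ∀ j → T (cornerBound σ j) × T (nearOK j)
      atCorner j = Equivalence.to (Boolₚ.T-∧ {cornerBound σ j}) (≡.subst T (corner j) (h (v j)))
      outer : ∀ w → T (outerVertexOK σ w)
      outer w = Equivalence.from Boolₚ.T-∨ (case isCorner? w of λ where
        (yes isCorner) → inj₁ (≡.subst T (≡.sym (dec-true (isCorner? w) isCorner)) tt)
        (no ¬corner)   → inj₂ (≡.subst T (atNonCorner w ¬corner) (h w)))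

    from : T (outerOK σ) × (∀ j → T (nearOK j)) → ∀ w → T (near w ℕ.+ outerDegree σ w ℕ.≡ᵇ 1)
    from (ok , nearOKs) w with Equivalence.to (T-outerOK σ) ok | isCorner? w
    ... | _ , bounds | yes (j , ≡.refl) = ≡.subst T (≡.sym (corner j)) (Equivalence.from Boolₚ.T-∧ (bounds j , nearOKs j))
    ... | outers , _ | no ¬corner       = case Equivalence.to Boolₚ.T-∨ (outers w) of λ where
      (inj₁ isCorner) → ⊥-elim (≡.subst T (dec-false (isCorner? w) ¬corner) isCorner)
      (inj₂ outer)    → ≡.subst T (≡.sym (atNonCorner w ¬corner)) outer

  ∀-clsV⇔ : ∀ (P : Vertex → Set) → (∀ w′ → P (clsV w′)) ⇔ ((∀ w → P (inj₁ w)) × (∀ j → P (inj₂ j)))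
  ∀-clsV⇔ P = mk⇔ (λ h → onto h ∘ inj₁ , onto h ∘ inj₂) (λ (olds , news) w′ → byClass olds news (clsV w′))
    where
    onto : (∀ w′ → P (clsV w′)) → ∀ u → P u
    onto h u = case clsV-surj u of λ { (w′ , ≡.refl) → h w′ }
    byClass : (∀ w → P (inj₁ w)) → (∀ j → P (inj₂ j)) → ∀ u → P u
    byClass olds news (inj₁ w) = olds w
    byClass olds news (inj₂ j) = news j

  private
    T-cong-≡ᵇ1 : ∀ {m n} → m ≡ n → T (m ℕ.≡ᵇ 1) ⇔ T (n ℕ.≡ᵇ 1)
    T-cong-≡ᵇ1 ≡.refl = ⇔.refl

    ∀-⇔ : ∀ {A : Set} {P Q : A → Set} → (∀ a → P a ⇔ Q a) → (∀ a → P a) ⇔ (∀ a → Q a)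
    ∀-⇔ P⇔Q = mk⇔ (λ h a → Equivalence.to (P⇔Q a) (h a)) (λ h a → Equivalence.from (P⇔Q a) (h a))

    T-⇔→≡ : ∀ {a b} → T a ⇔ T b → a ≡ b
    T-⇔→≡ T⇔T = Boolₚ.⇔→≡ {z = true} (⇔.trans (⇔.sym Boolₚ.T-≡) (⇔.trans T⇔T Boolₚ.T-≡))

  matching-G : ∀ ρ σ → AgreeOff squareEdges ρ σ →
    isMatching G (ρ ∘ old) ≡ outerOK σ ∧ squareOK (covered σ) (ρ ∘ squareEdge)
  matching-G ρ σ agree = T-⇔→≡ (begin
    T (isMatching G (ρ ∘ old))
      ∼⟨ T-allFin (nV G) (λ w → countFin (nE G) (λ a → ρ (old a) ∧ incident G a w) ℕ.≡ᵇ 1) ⟩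
    (∀ w → T (countFin (nE G) (λ a → ρ (old a) ∧ incident G a w) ℕ.≡ᵇ 1))
      ∼⟨ ∀-⇔ (λ w → T-cong-≡ᵇ1 (degree≡ w)) ⟩
    (∀ w → T (degree squareEdges ρ (inj₁ w) ℕ.+ outerDegree σ w ℕ.≡ᵇ 1))
      ∼⟨ oldVertices⇔ σ (λ w → degree squareEdges ρ (inj₁ w)) (λ j → cornerOK (covered σ j) (t j) (t (prev4 j)))
           (squareDegree-nonCorner ρ)
           (λ j → ≡.trans (≡.cong (λ n → n ℕ.+ outerDegree σ (v j) ℕ.≡ᵇ 1) (squareDegree-corner ρ j))
                          (cornerCount (t j) (t (prev4 j)) (outerDegree σ (v j)))) ⟩
    (T (outerOK σ) × (∀ j → T (cornerOK (covered σ j) (t j) (t (prev4 j)))))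
      ∼⟨ ⇔.refl ×-⇔ ⇔.sym (T-∧⁴ _) ⟩
    (T (outerOK σ) × T (squareOK (covered σ) t))
      ∼⟨ ⇔.sym Boolₚ.T-∧ ⟩
    T (outerOK σ ∧ squareOK (covered σ) t) ∎)
    where
    open EquationalReasoning
    open Classified G old
    t = ρ ∘ squareEdge
    degree≡ : ∀ w → countFin (nE G) (λ a → ρ (old a) ∧ incident G a w) ≡ degree squareEdges ρ (inj₁ w) ℕ.+ outerDegree σ w
    degree≡ w = ≡.trans (countFin≡degree inj₁ ⊎ₚ.inj₁-injective (λ _ → inj₁ (≡.refl , ≡.refl)) ρ w)
                        (tally-split ρ σ (λ c b → 𝟙 (incidentTo c (inj₁ w) ∧ b)) edgesOfG-↭ outer∉squareEdges agree)

  matching-G′ : ∀ ρ σ → AgreeOff renewedEdges ρ σ →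
    isMatching G′ (ρ ∘ clsE) ≡ outerOK σ ∧ renewedOK (covered σ) (ρ ∘ renewedEdge)
  matching-G′ ρ σ agree = T-⇔→≡ (begin
    T (isMatching G′ (ρ ∘ clsE))
      ∼⟨ T-allFin (nV G′) (λ w′ → countFin (nE G′) (λ a → ρ (clsE a) ∧ incident G′ a w′) ℕ.≡ᵇ 1) ⟩
    (∀ w′ → T (countFin (nE G′) (λ a → ρ (clsE a) ∧ incident G′ a w′) ℕ.≡ᵇ 1))
      ∼⟨ ∀-⇔ (λ w′ → T-cong-≡ᵇ1 (degree≡ w′)) ⟩
    (∀ w′ → T (total (clsV w′) ℕ.≡ᵇ 1))
      ∼⟨ ∀-clsV⇔ (λ u → T (total u ℕ.≡ᵇ 1)) ⟩
    ((∀ w → T (degree renewedEdges ρ (inj₁ w) ℕ.+ outerDegree σ w ℕ.≡ᵇ 1)) × (∀ j → T (total (inj₂ j) ℕ.≡ᵇ 1)))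
      ∼⟨ oldVertices⇔ σ (λ w → degree renewedEdges ρ (inj₁ w)) (λ j → spokeOK (covered σ j) (g j))
           (renewedDegree-nonCorner ρ)
           (λ j → ≡.trans (≡.cong (λ n → n ℕ.+ outerDegree σ (v j) ℕ.≡ᵇ 1) (renewedDegree-corner ρ j)) (spokeCount (g j) (outerDegree σ (v j))))
         ×-⇔ ∀-⇔ (λ j → T-cong-≡ᵇ1 (inner j)) ⟩
    ((T (outerOK σ) × (∀ j → T (spokeOK (covered σ j) (g j)))) × (∀ j → T (exactlyOne (g j) (s j) (s (prev4 j)))))
      ∼⟨ mk⇔ (λ ((ok , spokes) , rims) → ok , spokes , rims) (λ (ok , spokes , rims) → (ok , spokes) , rims) ⟩
    (T (outerOK σ) × (∀ j → T (spokeOK (covered σ j) (g j))) × (∀ j → T (exactlyOne (g j) (s j) (s (prev4 j)))))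
      ∼⟨ ⇔.refl ×-⇔ ⇔.sym (⇔.trans Boolₚ.T-∧ (T-∧⁴ _ ×-⇔ T-∧⁴ _)) ⟩
    (T (outerOK σ) × T (renewedOK (covered σ) τ))
      ∼⟨ ⇔.sym Boolₚ.T-∧ ⟩
    T (outerOK σ ∧ renewedOK (covered σ) τ) ∎)
    where
    open EquationalReasoning
    open Classified G′ clsE
    τ = ρ ∘ renewedEdge
    g s : Fin 4 → Bool
    g = spokes τ
    s = rim τ
    total : Vertex → ℕ
    total u = degree renewedEdges ρ u ℕ.+ degree outerEdges σ u
    degree≡ : ∀ w′ → countFin (nE G′) (λ a → ρ (clsE a) ∧ incident G′ a w′) ≡ total (clsV w′)
    degree≡ w′ = ≡.trans (countFin≡degree clsV (clsV-inj _ _) ends ρ w′)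
                         (tally-split ρ σ (λ c b → 𝟙 (incidentTo c (clsV w′) ∧ b)) edgesOfG′-↭ outer∉renewedEdges agree)
    inner : ∀ j → total (inj₂ j) ≡ 𝟙 (g j) ℕ.+ (𝟙 (s j) ℕ.+ 𝟙 (s (prev4 j)))
    inner j = ≡.trans (≡.cong₂ ℕ._+_ (renewedDegree-inner ρ j) (outerDegree-inner σ j)) (ℕₚ.+-identityʳ _)

module Factorization {c ℓ} (R : CommutativeRing c ℓ)
  (G : GraphWithOpenFaces) (S : SquareFace G) (G′ : GraphWithOpenFaces) (renewal : Renewal G S G′)
  (x xi : Fin (nF G) → CommutativeRing.Carrier R) (y : Fin (nE G) → CommutativeRing.Carrier R)
  (x*xi≈1 : ∀ f → CommutativeRing._≈_ R (CommutativeRing._*_ R (x f) (xi f)) (CommutativeRing.1# R))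
  (z : CommutativeRing.Carrier R) where
  open CommutativeRing R hiding (zero)
  open Eval R using (powZ; monomial)
  open FaceWeights R using (faceWeight; oneEdgeFactor; threeEdgeFactor; oneEdge-faceWeight; threeEdge-faceWeight)
  open Products R
  open Decomposition G S G′ renewal
  open SquareFace S
  open Renewal renewal
  open GraphWithOpenFaces using (isOpen; faceOf)
  private
    module NV = NewVars R G S G′ renewal x xi y

  xᶠ xiᶠ : Face → Carrier
  xᶠ (inj₁ f) = x f
  xᶠ (inj₂ _) = NV.xX'
  xiᶠ (inj₁ f) = xi f
  xiᶠ (inj₂ _) = z

  isOpenᶠ : Face → Bool
  isOpenᶠ (inj₁ f) = isOpen G f
  isOpenᶠ (inj₂ _) = false

  yᴱ : Edge → Carrier
  yᴱ (old a) = y a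
  yᴱ (gE k)  = 1#
  yᴱ (sE k)  = y (e (next4 (next4 k)))

  edgeWeight : List Edge → Assignment Edge → Carrier
  edgeWeight cs ρ = product (map (λ c → if ρ c then yᴱ c else 1#) cs)

  boundaryDifference : List Edge → Assignment Edge → Face → ℤ
  boundaryDifference cs ρ f = + onBoundary not cs ρ f ℤ.- + onBoundary (λ b → b) cs ρ f

  faceFactor : List Edge → Assignment Edge → Face → Carrier
  faceFactor cs ρ f = powZ (xᶠ f) (xiᶠ f) (faceExponent (isOpenᶠ f) (boundaryDifference cs ρ f))

  monomial≡ : ∀ H (cls : Fin (nE H) → Edge) (clsF : Fin (nF H) → Face) (clsF-inj : Injective _≡_ _≡_ clsF)
    (sides : ∀ a → SameEnds (clsF (faceOf H (a , false))) (clsF (faceOf H (a , true))) (faceL G S (cls a)) (faceR G S (cls a)))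
    (xH xiH : Fin (nF H) → Carrier) (yH : Fin (nE H) → Carrier) →
    (∀ f → xH f ≡ xᶠ (clsF f)) → (∀ f → xiH f ≡ xiᶠ (clsF f)) → (∀ f → isOpen H f ≡ isOpenᶠ (clsF f)) → (∀ a → yH a ≡ yᴱ (cls a)) →
    ∀ ρ → monomial H xH xiH yH (ρ ∘ cls) ≡
          edgeWeight (Classified.edgesOf H cls) ρ * product (map (faceFactor (Classified.edgesOf H cls) ρ) (map clsF (finList (nF H))))
  monomial≡ H cls clsF clsF-inj sides xH xiH yH xH≡ xiH≡ open≡ yH≡ ρ = ≡.cong₂ _*_ edgePart facePart
    where
    open Classified H cls
    open ≡.≡-Reasoning
    tabulate≡map : ∀ {A : Set} {n} (h : A → Carrier) (g : Fin n → A) → tabulate (h ∘ g) ≡ map h (map g (finList n))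
    tabulate≡map h g = ≡.trans (≡.sym (map-tabulate g h)) (≡.cong (map h) (≡.sym (map-tabulate (λ i → i) g)))
    edgePart : Eval.prodFin R (nE H) (λ a → if ρ (cls a) then yH a else 1#) ≡ edgeWeight edgesOf ρ
    edgePart = begin
      Eval.prodFin R (nE H) (λ a → if ρ (cls a) then yH a else 1#)
        ≡⟨ prodFin≡product (nE H) _ ⟩
      product (tabulate (λ a → if ρ (cls a) then yH a else 1#))
        ≡⟨ ≡.cong product (tabulate-cong λ a → ≡.cong (λ w → if ρ (cls a) then w else 1#) (yH≡ a)) ⟩
      product (tabulate (λ a → if ρ (cls a) then yᴱ (cls a) else 1#))
        ≡⟨ ≡.cong product (tabulate≡map (λ c → if ρ c then yᴱ c else 1#) cls) ⟩
      edgeWeight edgesOf ρ ∎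
    exponent≡ : ∀ f → epsilon H (ρ ∘ cls) f ≡ faceExponent (isOpenᶠ (clsF f)) (boundaryDifference edgesOf ρ (clsF f))
    exponent≡ f = ≡.trans (epsilon≡faceExponent H (ρ ∘ cls) f)
      (≡.cong₂ faceExponent (open≡ f) (≡.cong₂ (λ m n → + m ℤ.- + n)
        (countDart≡onBoundary clsF clsF-inj sides not ρ f) (countDart≡onBoundary clsF clsF-inj sides (λ b → b) ρ f)))
    faceFactor≡ : ∀ f → powZ (xH f) (xiH f) (epsilon H (ρ ∘ cls) f) ≡ faceFactor edgesOf ρ (clsF f)
    faceFactor≡ f = ≡.trans (≡.cong₂ (λ a b → powZ a b (epsilon H (ρ ∘ cls) f)) (xH≡ f) (xiH≡ f))
                            (≡.cong (powZ (xᶠ (clsF f)) (xiᶠ (clsF f))) (exponent≡ f))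
    facePart : Eval.prodFin R (nF H) (λ f → powZ (xH f) (xiH f) (epsilon H (ρ ∘ cls) f)) ≡
               product (map (faceFactor edgesOf ρ) (map clsF (finList (nF H))))
    facePart = begin
      Eval.prodFin R (nF H) (λ f → powZ (xH f) (xiH f) (epsilon H (ρ ∘ cls) f))
        ≡⟨ prodFin≡product (nF H) _ ⟩
      product (tabulate (λ f → powZ (xH f) (xiH f) (epsilon H (ρ ∘ cls) f)))
        ≡⟨ ≡.cong product (tabulate-cong faceFactor≡) ⟩
      product (tabulate (faceFactor edgesOf ρ ∘ clsF))
        ≡⟨ ≡.cong product (tabulate≡map (faceFactor edgesOf ρ) clsF) ⟩
      product (map (faceFactor edgesOf ρ) (map clsF (finList (nF H)))) ∎

  -- The factor of F_k from its outer edges, normalised as if one square edge of F_k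
  -- were matched (hence the − 1 in the exponent difference β − α).
  borderFactor : Assignment Edge → Fin 4 → Carrier
  borderFactor σ k = faceWeight (x (F k)) (xi (F k)) (isOpen G (F k)) (boundaryDifference outerEdges σ (inj₁ (F k)) ℤ.- + 1)

  outerWeight : Assignment Edge → Carrier
  outerWeight σ = edgeWeight outerEdges σ * product (map (faceFactor outerEdges σ) otherFaces)

  module Local (σ : Assignment Edge) = SquareMove.Weights R (y ∘ e) (x ∘ F) (xi ∘ F) (borderFactor σ) (x X) (xi X) z

  private
    open import Relation.Binary.Reasoning.Setoid setoid

    edgeWeight-split : ∀ {es cs} ρ σ → es ↭ cs ++ outerEdges → (∀ {c} → c ∈ outerEdges → c ∉ cs) → AgreeOff cs ρ σ →
                       edgeWeight es ρ ≈ edgeWeight cs ρ * edgeWeight outerEdges σ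
    edgeWeight-split {es} {cs} ρ σ es↭ disjoint agree = begin
      edgeWeight es ρ                                ≈⟨ product-↭ (↭ₚ.map⁺ _ es↭) ⟩
      product (map w (cs ++ outerEdges))             ≡⟨ ≡.cong product (map-++ w cs outerEdges) ⟩
      product (map w cs ++ map w outerEdges)         ≈⟨ product-++ (map w cs) (map w outerEdges) ⟩
      edgeWeight cs ρ * edgeWeight outerEdges ρ      ≈⟨ *-congˡ (product-map-cong outerEdges λ {c} c∈ →
                                                          reflexive (≡.cong (λ b → if b then yᴱ c else 1#) (agree c (disjoint c∈)))) ⟩
      edgeWeight cs ρ * edgeWeight outerEdges σ      ∎
      where
      w = λ c → if ρ c then yᴱ c else 1#

    faces-split : ∀ {fs} es ρ head → fs ↭ head ∷ borderFaces ++ otherFaces →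
                  product (map (faceFactor es ρ) fs) ≈
                  faceFactor es ρ head * (product (map (faceFactor es ρ) borderFaces) * product (map (faceFactor es ρ) otherFaces))
    faces-split es ρ head fs↭ = trans (product-↭ (↭ₚ.map⁺ _ fs↭))
      (*-congˡ (trans (reflexive (≡.cong product (map-++ (faceFactor es ρ) borderFaces otherFaces)))
                      (product-++ (map (faceFactor es ρ) borderFaces) (map (faceFactor es ρ) otherFaces))))

    otherFaces-agree : ∀ es ρ σ → (∀ q f → ¬ IsSquareFace f → onBoundary q es ρ (inj₁ f) ≡ onBoundary q outerEdges σ (inj₁ f)) →
                       product (map (faceFactor es ρ) otherFaces) ≈ product (map (faceFactor outerEdges σ) otherFaces)
    otherFaces-agree es ρ σ same = product-map-cong otherFaces λ c∈ → case ∈-otherFaces⁻ c∈ of λ where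
      (f , ≡.refl , ¬square) → reflexive (≡.cong (λ n → powZ (x f) (xi f) (faceExponent (isOpen G f) n))
                                  (≡.cong₂ (λ m n → + m ℤ.- + n) (same not f ¬square) (same (λ b → b) f ¬square)))

    rearrange : ∀ Y₁ Y₂ X Φ Ψ → (Y₁ * Y₂) * (X * (Φ * Ψ)) ≈ (Y₂ * Ψ) * (Y₁ * (X * Φ))
    rearrange = solve 5 (λ Y₁ Y₂ X Φ Ψ → (Y₁ :* Y₂) :* (X :* (Φ :* Ψ)) := (Y₂ :* Ψ) :* (Y₁ :* (X :* Φ))) refl
      where open import Algebra.Solver.Ring.NaturalCoefficients.Default commutativeSemiring

  module SquareSide (ρ σ : Assignment Edge) (agree : AgreeOff squareEdges ρ σ) where
    t : Assignment (Fin 4)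
    t = ρ ∘ squareEdge

    squareEdgeProduct xFactor borderProduct otherProduct : Carrier
    squareEdgeProduct = ∏ (map (y ∘ e) (keep t (finList 4)))
    xFactor           = powZ (x X) (xi X) (faceExponent false (+ count (not ∘ t) ℤ.- + count t))
    borderProduct     = ∏ (map (λ k → oneEdgeFactor (t k) (x (F k)) (borderFactor σ k)) (finList 4))
    otherProduct      = product (map (faceFactor outerEdges σ) otherFaces)

    boundary-split : ∀ q f → onBoundary q edgesOfG ρ f ≡ onBoundary q squareEdges ρ f ℕ.+ onBoundary q outerEdges σ f
    boundary-split q f = tally-split ρ σ (λ c b → sidesOn c f ℕ.* 𝟙 (q b)) edgesOfG-↭ outer∉squareEdges agree

    boundary-X : ∀ q → onBoundary q edgesOfG ρ (inj₁ X) ≡ count (q ∘ t)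
    boundary-X q = ≡.trans (boundary-split q (inj₁ X))
      (≡.trans (≡.cong₂ ℕ._+_ (squareBoundary-X q ρ) (outerBoundary-X q σ)) (ℕₚ.+-identityʳ _))

    boundary-F : ∀ q k → onBoundary q edgesOfG ρ (inj₁ (F k)) ≡ 𝟙 (q (t k)) ℕ.+ onBoundary q outerEdges σ (inj₁ (F k))
    boundary-F q k = ≡.trans (boundary-split q (inj₁ (F k))) (≡.cong (ℕ._+ onBoundary q outerEdges σ (inj₁ (F k))) (squareBoundary-F q ρ k))

    boundary-other : ∀ q f → ¬ IsSquareFace f → onBoundary q edgesOfG ρ (inj₁ f) ≡ onBoundary q outerEdges σ (inj₁ f)
    boundary-other q f ¬square = ≡.trans (boundary-split q (inj₁ f))
      (≡.cong (ℕ._+ onBoundary q outerEdges σ (inj₁ f)) (squareBoundary-other q ρ f ¬square))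

    faceFactor-X : faceFactor edgesOfG ρ (inj₁ X) ≡ xFactor
    faceFactor-X = ≡.cong₂ (λ o n → powZ (x X) (xi X) (faceExponent o n)) X-closed
                           (≡.cong₂ (λ m n → + m ℤ.- + n) (boundary-X not) (boundary-X (λ b → b)))

    faceFactor-F : ∀ k → faceFactor edgesOfG ρ (inj₁ (F k)) ≈ oneEdgeFactor (t k) (x (F k)) (borderFactor σ k)
    faceFactor-F k = trans (reflexive (≡.cong (faceWeight (x (F k)) (xi (F k)) (isOpen G (F k)))
                             (≡.cong₂ (λ m n → + m ℤ.- + n) (boundary-F not k) (boundary-F (λ b → b) k))))
                           (oneEdge-faceWeight (x (F k)) (xi (F k)) (x*xi≈1 (F k)) (isOpen G (F k)) _ _ (t k))

    borderFaces-product : product (map (faceFactor edgesOfG ρ) borderFaces) ≈ borderProduct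
    borderFaces-product = trans (product-map-cong (finList 4) λ {k} _ → faceFactor-F k)
                                (product≈∏ (map (λ k → oneEdgeFactor (t k) (x (F k)) (borderFactor σ k)) (finList 4)))

  monomial-G : ∀ ρ σ → AgreeOff squareEdges ρ σ → monomial G x xi y (ρ ∘ old) ≈ outerWeight σ * Local.squareTerm σ (ρ ∘ squareEdge)
  monomial-G ρ σ agree = begin
    monomial G x xi y (ρ ∘ old)
      ≡⟨ monomial≡ G old inj₁ ⊎ₚ.inj₁-injective (λ _ → inj₁ (≡.refl , ≡.refl)) x xi y
           (λ _ → ≡.refl) (λ _ → ≡.refl) (λ _ → ≡.refl) (λ _ → ≡.refl) ρ ⟩
    edgeWeight edgesOfG ρ * product (map (faceFactor edgesOfG ρ) facesOfG)
      ≈⟨ *-cong (edgeWeight-split ρ σ edgesOfG-↭ outer∉squareEdges agree) (faces-split edgesOfG ρ (inj₁ X) facesOfG-↭) ⟩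
    (edgeWeight squareEdges ρ * edgeWeight outerEdges σ) *
    (faceFactor edgesOfG ρ (inj₁ X) * (product (map (faceFactor edgesOfG ρ) borderFaces) * product (map (faceFactor edgesOfG ρ) otherFaces)))
      ≈⟨ *-cong (*-congʳ (product-selected t (y ∘ e) (finList 4)))
                (*-cong (reflexive faceFactor-X) (*-cong borderFaces-product (otherFaces-agree edgesOfG ρ σ boundary-other))) ⟩
    (squareEdgeProduct * edgeWeight outerEdges σ) * (xFactor * (borderProduct * otherProduct))
      ≈⟨ rearrange squareEdgeProduct (edgeWeight outerEdges σ) xFactor borderProduct otherProduct ⟩
    outerWeight σ * Local.squareTerm σ t ∎
    where open SquareSide ρ σ agree

  private
    newX≡ : ∀ a → NV.newX a ≡ xᶠ (clsF a)
    newX≡ a with clsF a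
    ... | inj₁ f = ≡.refl
    ... | inj₂ _ = ≡.refl

    newXi≡ : ∀ a → NV.newXi z a ≡ xiᶠ (clsF a)
    newXi≡ a with clsF a
    ... | inj₁ f = ≡.refl
    ... | inj₂ _ = ≡.refl

    newY≡ : ∀ a → NV.newY a ≡ yᴱ (clsE a)
    newY≡ a with clsE a
    ... | old b = ≡.refl
    ... | gE k  = ≡.refl
    ... | sE k  = ≡.refl

    isOpen′≡ : ∀ a → isOpen G′ a ≡ isOpenᶠ (clsF a)
    isOpen′≡ a with clsF a in eq
    ... | inj₁ f  = open-old a f eq
    ... | inj₂ tt = open-new a eq

  module RenewedSide (ρ σ : Assignment Edge) (agree : AgreeOff renewedEdges ρ σ) where
    τ : Assignment (Fin 4 ⊎ Fin 4)
    τ = ρ ∘ renewedEdge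

    g s : Fin 4 → Bool
    g = spokes τ
    s = rim τ

    rimEdgeProduct x′Factor borderProduct otherProduct : Carrier
    rimEdgeProduct = ∏ (map (y ∘ e ∘ next4 ∘ next4) (keep s (finList 4)))
    x′Factor       = powZ NV.xX' z (faceExponent false (+ count (not ∘ s) ℤ.- + count s))
    borderProduct  = ∏ (map (λ k → threeEdgeFactor (g k) (s k) (g (next4 k)) (x (F k)) (xi (F k)) (borderFactor σ k)) (finList 4))
    otherProduct   = product (map (faceFactor outerEdges σ) otherFaces)

    renewedEdges-product : edgeWeight renewedEdges ρ ≈ rimEdgeProduct
    renewedEdges-product = begin
      edgeWeight renewedEdges ρ
        ≈⟨ product-++ (map (λ k → if g k then 1# else 1#) (finList 4)) (map (λ k → if s k then y (e (next4 (next4 k))) else 1#) (finList 4)) ⟩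
      product (map (λ k → if g k then 1# else 1#) (finList 4)) * product (map (λ k → if s k then y (e (next4 (next4 k))) else 1#) (finList 4))
        ≈⟨ *-cong (product-ones (finList 4) (λ k → spoke (g k))) (product-selected s (y ∘ e ∘ next4 ∘ next4) (finList 4)) ⟩
      1# * rimEdgeProduct
        ≈⟨ *-identityˡ rimEdgeProduct ⟩
      rimEdgeProduct ∎
      where
      spoke : ∀ b → (if b then 1# else 1#) ≈ 1#
      spoke true  = refl
      spoke false = refl

    boundary-split : ∀ q f → onBoundary q edgesOfG′ ρ f ≡ onBoundary q renewedEdges ρ f ℕ.+ onBoundary q outerEdges σ f
    boundary-split q f = tally-split ρ σ (λ c b → sidesOn c f ℕ.* 𝟙 (q b)) edgesOfG′-↭ outer∉renewedEdges agree

    boundary-X′ : ∀ q → onBoundary q edgesOfG′ ρ (inj₂ tt) ≡ count (q ∘ s)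
    boundary-X′ q = ≡.trans (boundary-split q (inj₂ tt))
      (≡.trans (≡.cong₂ ℕ._+_ (renewedBoundary-X′ q ρ) (outerBoundary-X′ q σ)) (ℕₚ.+-identityʳ _))

    boundary-F : ∀ q k → onBoundary q edgesOfG′ ρ (inj₁ (F k)) ≡
                         (𝟙 (q (g k)) ℕ.+ (𝟙 (q (s k)) ℕ.+ 𝟙 (q (g (next4 k))))) ℕ.+ onBoundary q outerEdges σ (inj₁ (F k))
    boundary-F q k = ≡.trans (boundary-split q (inj₁ (F k))) (≡.cong (ℕ._+ onBoundary q outerEdges σ (inj₁ (F k))) (renewedBoundary-F q ρ k))

    boundary-other : ∀ q f → ¬ IsSquareFace f → onBoundary q edgesOfG′ ρ (inj₁ f) ≡ onBoundary q outerEdges σ (inj₁ f)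
    boundary-other q f ¬square = ≡.trans (boundary-split q (inj₁ f))
      (≡.cong (ℕ._+ onBoundary q outerEdges σ (inj₁ f)) (renewedBoundary-other q ρ f ¬square))

    faceFactor-X′ : faceFactor edgesOfG′ ρ (inj₂ tt) ≡ x′Factor
    faceFactor-X′ = ≡.cong (λ n → powZ NV.xX' z (faceExponent false n)) (≡.cong₂ (λ m n → + m ℤ.- + n) (boundary-X′ not) (boundary-X′ (λ b → b)))

    faceFactor-F : ∀ k → faceFactor edgesOfG′ ρ (inj₁ (F k)) ≈ threeEdgeFactor (g k) (s k) (g (next4 k)) (x (F k)) (xi (F k)) (borderFactor σ k)
    faceFactor-F k = trans (reflexive (≡.cong (faceWeight (x (F k)) (xi (F k)) (isOpen G (F k)))
                             (≡.cong₂ (λ m n → + m ℤ.- + n) (boundary-F not k) (boundary-F (λ b → b) k))))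
                           (threeEdge-faceWeight (x (F k)) (xi (F k)) (x*xi≈1 (F k)) (isOpen G (F k)) _ _ (g k) (s k) (g (next4 k)))

    borderFaces-product : product (map (faceFactor edgesOfG′ ρ) borderFaces) ≈ borderProduct
    borderFaces-product = trans (product-map-cong (finList 4) λ {k} _ → faceFactor-F k)
      (product≈∏ (map (λ k → threeEdgeFactor (g k) (s k) (g (next4 k)) (x (F k)) (xi (F k)) (borderFactor σ k)) (finList 4)))

  monomial-G′ : ∀ ρ σ → AgreeOff renewedEdges ρ σ →
    monomial G′ NV.newX (NV.newXi z) NV.newY (ρ ∘ clsE) ≈ outerWeight σ * Local.renewedTerm σ (ρ ∘ renewedEdge)
  monomial-G′ ρ σ agree = begin
    monomial G′ NV.newX (NV.newXi z) NV.newY (ρ ∘ clsE)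
      ≡⟨ monomial≡ G′ clsE clsF (clsF-inj _ _) faces NV.newX (NV.newXi z) NV.newY newX≡ newXi≡ isOpen′≡ newY≡ ρ ⟩
    edgeWeight edgesOfG′ ρ * product (map (faceFactor edgesOfG′ ρ) facesOfG′)
      ≈⟨ *-cong (edgeWeight-split ρ σ edgesOfG′-↭ outer∉renewedEdges agree) (faces-split edgesOfG′ ρ (inj₂ tt) facesOfG′-↭) ⟩
    (edgeWeight renewedEdges ρ * edgeWeight outerEdges σ) *
    (faceFactor edgesOfG′ ρ (inj₂ tt) * (product (map (faceFactor edgesOfG′ ρ) borderFaces) * product (map (faceFactor edgesOfG′ ρ) otherFaces)))
      ≈⟨ *-cong (*-congʳ renewedEdges-product)
                (*-cong (reflexive faceFactor-X′) (*-cong borderFaces-product (otherFaces-agree edgesOfG′ ρ σ boundary-other))) ⟩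
    (rimEdgeProduct * edgeWeight outerEdges σ) * (x′Factor * (borderProduct * otherProduct))
      ≈⟨ rearrange rimEdgeProduct (edgeWeight outerEdges σ) x′Factor borderProduct otherProduct ⟩
    outerWeight σ * Local.renewedTerm σ τ ∎
    where open RenewedSide ρ σ agree

module MatchingSums {c ℓ} (R : CommutativeRing c ℓ)
  (G : GraphWithOpenFaces) (S : SquareFace G) (G′ : GraphWithOpenFaces) (renewal : Renewal G S G′)
  (x xi : Fin (nF G) → CommutativeRing.Carrier R) (y : Fin (nE G) → CommutativeRing.Carrier R)
  (x*xi≈1 : ∀ f → CommutativeRing._≈_ R (CommutativeRing._*_ R (x f) (xi f)) (CommutativeRing.1# R))
  (z : CommutativeRing.Carrier R)
  (xX′*z≈1 : CommutativeRing._≈_ R (CommutativeRing._*_ R (NewVars.xX' R G S G′ renewal x xi y) z) (CommutativeRing.1# R)) where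
  open CommutativeRing R hiding (zero)
  open Eval R using (powZ; monomial; mPoly)
  open Products R using (prodFin-cong)
  open AssignmentSumProperties R
  open SquareMove R using (val; when; _⊕_; val-⊕)
  open Decomposition G S G′ renewal
  open Factorization R G S G′ renewal x xi y x*xi≈1 z
  open SquareFace S
  open Renewal renewal
  open import Relation.Binary.Reasoning.Setoid setoid
  private
    module NV = NewVars R G S G′ renewal x xi y
    _≟ᴸ_ : DecidableEquality (Fin 4 ⊎ Fin 4)
    _≟ᴸ_ = ⊎ₚ.≡-dec Finₚ._≟_ Finₚ._≟_
    ∑ᴱ = AssignmentSum.∑ _+_ _≟ᴱ_

  matchingTerm : ∀ H → (Fin (nF H) → Carrier) → (Fin (nF H) → Carrier) → (Fin (nE H) → Carrier) → Assignment (Fin (nE H)) → Carrier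
  matchingTerm H xH xiH yH M = if isMatching H M then monomial H xH xiH yH M else 0#

  matchingTerm-cong : ∀ H xH xiH yH → Respects≗ (matchingTerm H xH xiH yH)
  matchingTerm-cong H xH xiH yH {M} {M′} M≗M′ = reflexive (≡.cong₂ (λ b m → if b then m else 0#) (isMatching-cong H M≗M′)
    (≡.cong₂ _*_ (prodFin-cong (nE H) λ a → ≡.cong (λ b → if b then yH a else 1#) (M≗M′ a))
                 (prodFin-cong (nF H) λ f → ≡.cong (powZ (xH f) (xiH f)) (epsilon-cong H M≗M′ f))))

  Φ : Assignment Edge → Assignment (Fin 4) → Carrier
  Φ σ t = if outerOK σ then outerWeight σ * val (Local.squareSummand σ (covered σ) t) else 0#

  Φ′ : Assignment Edge → Assignment (Fin 4 ⊎ Fin 4) → Carrier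
  Φ′ σ τ = if outerOK σ then outerWeight σ * val (Local.renewedSummand σ (covered σ) τ) else 0#

  private
    factor-if : ∀ a b {m} k w → m ≈ k * w → (if a ∧ b then m else 0#) ≈ (if a then k * val (when b w) else 0#)
    factor-if true  true  k w eq = eq
    factor-if true  false k w eq = sym (zeroʳ k)
    factor-if false b     k w eq = refl

    collapse : ∀ {A : Set} (_≟_ : DecidableEquality A) as t₀ b K (Λ : Assignment A → Maybe Carrier) →
               AssignmentSum.∑ _+_ _≟_ as t₀ (λ t → if b then K * val (Λ t) else 0#) ≈
               (if b then K * val (AssignmentSum.∑ _⊕_ _≟_ as t₀ Λ) else 0#)
    collapse _≟_ as t₀ true  K Λ = trans (∑-*ˡ _≟_ as t₀ K (val ∘ Λ)) (*-congˡ (sym (∑-homo _⊕_ val val-⊕ _≟_ as t₀ Λ)))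
    collapse _≟_ as t₀ false K Λ = ∑-zero _≟_ as t₀

  squareStep : ∀ σ ρ t → AgreeOff squareEdges ρ σ → (∀ k → t k ≡ ρ (squareEdge k)) → matchingTerm G x xi y (ρ ∘ old) ≈ Φ σ t
  squareStep σ ρ t agree t≗ = begin
    matchingTerm G x xi y (ρ ∘ old)
      ≡⟨ ≡.cong (λ b → if b then monomial G x xi y (ρ ∘ old) else 0#) (matching-G ρ σ agree) ⟩
    (if outerOK σ ∧ squareOK (covered σ) (ρ ∘ squareEdge) then monomial G x xi y (ρ ∘ old) else 0#)
      ≈⟨ factor-if (outerOK σ) _ (outerWeight σ) _ (monomial-G ρ σ agree) ⟩
    Φ σ (ρ ∘ squareEdge)
      ≡⟨ ≡.cong (λ m → if outerOK σ then outerWeight σ * val m else 0#) (Local.squareSummand-cong σ (covered σ) (≡.sym ∘ t≗)) ⟩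
    Φ σ t ∎

  renewedStep : ∀ σ ρ τ → AgreeOff renewedEdges ρ σ → (∀ i → τ i ≡ ρ (renewedEdge i)) →
                matchingTerm G′ NV.newX (NV.newXi z) NV.newY (ρ ∘ clsE) ≈ Φ′ σ τ
  renewedStep σ ρ τ agree τ≗ = begin
    matchingTerm G′ NV.newX (NV.newXi z) NV.newY (ρ ∘ clsE)
      ≡⟨ ≡.cong (λ b → if b then monomial G′ NV.newX (NV.newXi z) NV.newY (ρ ∘ clsE) else 0#) (matching-G′ ρ σ agree) ⟩
    (if outerOK σ ∧ renewedOK (covered σ) (ρ ∘ renewedEdge) then monomial G′ NV.newX (NV.newXi z) NV.newY (ρ ∘ clsE) else 0#)
      ≈⟨ factor-if (outerOK σ) _ (outerWeight σ) _ (monomial-G′ ρ σ agree) ⟩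
    Φ′ σ (ρ ∘ renewedEdge)
      ≡⟨ ≡.cong (λ m → if outerOK σ then outerWeight σ * val m else 0#) (Local.renewedSummand-cong σ (covered σ) (≡.sym ∘ τ≗)) ⟩
    Φ′ σ τ ∎

  nothingMatched : Assignment Edge
  nothingMatched _ = false

  outerSum : (Assignment Edge → Carrier) → Carrier
  outerSum = ∑ᴱ outerEdges nothingMatched

  squareContribution renewedContribution : Assignment Edge → Carrier
  squareContribution σ  = if outerOK σ then outerWeight σ * val (Local.squareSum σ (covered σ) (σ ∘ squareEdge)) else 0#
  renewedContribution σ = if outerOK σ then outerWeight σ * val (Local.renewedSum σ (covered σ) (σ ∘ renewedEdge)) else 0#

  mPoly-G : mPoly G x xi y ≈ outerSum squareContribution
  mPoly-G = begin
    mPoly G x xi y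
      ≈⟨ subsetSum≈∑ (nE G) _ (matchingTerm-cong G x xi y) (λ _ → false) ⟩
    AssignmentSum.∑ _+_ Finₚ._≟_ (finList (nE G)) (λ _ → false) (matchingTerm G x xi y)
      ≈⟨ ∑-map Finₚ._≟_ _≟ᴱ_ old old-injective (finList (nE G)) nothingMatched (λ _ → false) (λ _ → ≡.refl)
           (λ ρ M _ M≗ → matchingTerm-cong G x xi y (≡.sym ∘ M≗)) ⟨
    ∑ᴱ edgesOfG nothingMatched onG
      ≈⟨ ∑-↭ _≟ᴱ_ (↭.trans edgesOfG-↭ (↭ₚ.++-comm squareEdges outerEdges)) nothingMatched onG
           (λ ρ≗ρ′ → matchingTerm-cong G x xi y (ρ≗ρ′ ∘ old)) ⟩
    ∑ᴱ (outerEdges ++ squareEdges) nothingMatched onG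
      ≈⟨ ∑-++ _≟ᴱ_ outerEdges squareEdges nothingMatched onG ⟩
    outerSum (λ σ → ∑ᴱ squareEdges σ onG)
      ≈⟨ ∑-cong _≟ᴱ_ outerEdges nothingMatched (λ σ _ → trans
           (∑-map Finₚ._≟_ _≟ᴱ_ squareEdge squareEdge-injective (finList 4) σ (σ ∘ squareEdge) (λ _ → ≡.refl) (squareStep σ))
           (collapse Finₚ._≟_ (finList 4) (σ ∘ squareEdge) (outerOK σ) (outerWeight σ) (Local.squareSummand σ (covered σ)))) ⟩
    outerSum squareContribution ∎
    where
    onG : Assignment Edge → Carrier
    onG ρ = matchingTerm G x xi y (ρ ∘ old)

  mPoly-G′ : mPoly G′ NV.newX (NV.newXi z) NV.newY ≈ outerSum renewedContribution
  mPoly-G′ = begin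
    mPoly G′ NV.newX (NV.newXi z) NV.newY
      ≈⟨ subsetSum≈∑ (nE G′) _ (matchingTerm-cong G′ NV.newX (NV.newXi z) NV.newY) (λ _ → false) ⟩
    AssignmentSum.∑ _+_ Finₚ._≟_ (finList (nE G′)) (λ _ → false) (matchingTerm G′ NV.newX (NV.newXi z) NV.newY)
      ≈⟨ ∑-map Finₚ._≟_ _≟ᴱ_ clsE (clsE-inj _ _) (finList (nE G′)) nothingMatched (λ _ → false) (λ _ → ≡.refl)
           (λ ρ M _ M≗ → matchingTerm-cong G′ NV.newX (NV.newXi z) NV.newY (≡.sym ∘ M≗)) ⟨
    ∑ᴱ edgesOfG′ nothingMatched onG′
      ≈⟨ ∑-↭ _≟ᴱ_ (↭.trans edgesOfG′-↭ (↭ₚ.++-comm renewedEdges outerEdges)) nothingMatched onG′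
           (λ ρ≗ρ′ → matchingTerm-cong G′ NV.newX (NV.newXi z) NV.newY (ρ≗ρ′ ∘ clsE)) ⟩
    ∑ᴱ (outerEdges ++ renewedEdges) nothingMatched onG′
      ≈⟨ ∑-++ _≟ᴱ_ outerEdges renewedEdges nothingMatched onG′ ⟩
    outerSum (λ σ → ∑ᴱ renewedEdges σ onG′)
      ≈⟨ ∑-cong _≟ᴱ_ outerEdges nothingMatched (λ σ _ → trans
           (∑-map _≟ᴸ_ _≟ᴱ_ renewedEdge renewedEdge-injective renewedIndices σ (σ ∘ renewedEdge) (λ _ → ≡.refl) (renewedStep σ))
           (collapse _≟ᴸ_ renewedIndices (σ ∘ renewedEdge) (outerOK σ) (outerWeight σ) (Local.renewedSummand σ (covered σ)))) ⟩
    outerSum renewedContribution ∎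
    where
    onG′ : Assignment Edge → Carrier
    onG′ ρ = matchingTerm G′ NV.newX (NV.newXi z) NV.newY (ρ ∘ clsE)

  renewedContribution≈squareContribution : ∀ σ → renewedContribution σ ≈ squareContribution σ
  renewedContribution≈squareContribution σ = byOuterOK (outerOK σ)
    where
    byOuterOK : ∀ b → (if b then outerWeight σ * val (Local.renewedSum σ (covered σ) (σ ∘ renewedEdge)) else 0#) ≈
                      (if b then outerWeight σ * val (Local.squareSum σ (covered σ) (σ ∘ squareEdge)) else 0#)
    byOuterOK true  = *-congˡ (sym (Local.squareSum≈renewedSum σ (x*xi≈1 X) xX′*z≈1 (covered σ) (σ ∘ squareEdge) (σ ∘ renewedEdge)))
    byOuterOK false = refl

  outerSum-cong : ∀ {F F′} → (∀ σ → F σ ≈ F′ σ) → outerSum F ≈ outerSum F′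
  outerSum-cong F≈F′ = ∑-cong _≟ᴱ_ outerEdges nothingMatched (λ σ _ → F≈F′ σ)

mainTheorem7 : ∀ {c ℓ : Level} (R : CommutativeRing c ℓ)
    (G : GraphWithOpenFaces) (S : SquareFace G)
    (G' : GraphWithOpenFaces) (T : Renewal G S G')
    (x xi : Fin (nF G) → CommutativeRing.Carrier R)
    (y : Fin (nE G) → CommutativeRing.Carrier R) →
    (∀ f → CommutativeRing._≈_ R (CommutativeRing._*_ R (x f) (xi f)) (CommutativeRing.1# R)) →
    (z : CommutativeRing.Carrier R) →
    CommutativeRing._≈_ R (CommutativeRing._*_ R (NewVars.xX' R G S G' T x xi y) z) (CommutativeRing.1# R) →
    CommutativeRing._≈_ R
      (Eval.mPoly R G' (NewVars.newX R G S G' T x xi y) (NewVars.newXi R G S G' T x xi y z) (NewVars.newY R G S G' T x xi y))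
      (Eval.mPoly R G x xi y)
mainTheorem7 R G S G' T x xi y x*xi≈1 z xX′*z≈1 = begin
  Eval.mPoly R G' NV.newX (NV.newXi z) NV.newY  ≈⟨ mPoly-G′ ⟩
  outerSum renewedContribution                   ≈⟨ outerSum-cong renewedContribution≈squareContribution ⟩
  outerSum squareContribution                    ≈⟨ mPoly-G ⟨
  Eval.mPoly R G x xi y                          ∎
  where
  module NV = NewVars R G S G' T x xi y
  open CommutativeRing R using (setoid)
  open import Relation.Binary.Reasoning.Setoid setoid
  open MatchingSums R G S G' T x xi y x*xi≈1 z xX′*z≈1
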